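{- Every monotone outerplanar DAG admits a vertex order whose twist size is at most $4$ (i.e., with no $5$-twist).
   Context: Stellating an edge $\{s,t\}$ on the outer face of an outerplanar graph means adding a new vertex $x$ together with edges joining $x$ to $s$ and to $t$; each edge may be stellated at most once. The stellation is monotone if the new edges are directed either as $(s,x),(t,x)$ or as $(x,s),(x,t)$. A monotone outerplanar DAG is a directed graph obtained from a single directed edge by repeatedly applying monotone stellations. A vertex order of a DAG $G=(V,E)$ is a total order $\sigma$ of $V$ with $u<_\sigma v$ for all $(u,v)\in E$. For $k\ge2$, pairwise vertex-disjoint edges $(s_1,t_1),\dots,(s_k,t_k)$ form a $k$-twist if $s_1<_\sigma\dots<_\sigma s_k<_\sigma t_1<_\sigma\dots<_\sigma t_k$; the twist size of $\sigma$ is the largest $k$ for which a $k$-twist exists. -}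

module Defs where

open import Data.Nat using (ℕ; zero; suc; _<_)
open import Data.Fin using (Fin)
import Data.Fin as F
open import Data.Product using (_×_; _,_; proj₁; proj₂; Σ)
open import Data.List using (List; []; _∷_; _++_)
open import Data.List.Relation.Unary.Any using (_─_)
open import Data.List.Membership.Propositional using (_∈_)
open import Relation.Binary.PropositionalEquality using (_≡_; _≢_)

-- Vertices are natural numbers 0,…,n-1; a directed edge (u , v) means u → v.
Edge : Set
Edge = ℕ × ℕ

src tgt : Edge → ℕ
src = proj₁
tgt = proj₂

-- MonotoneOuterplanarDAG n E A :
--   the DAG with vertex set {0,…,n-1} and edge list E is obtained from a single
--   directed edge by monotone stellations; A is the list of edges that are still
--   available for stellation (edges on the outer face not yet stellated).
data MonotoneOuterplanarDAG : ℕ → List Edge → List Edge → Set where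
  start   : MonotoneOuterplanarDAG 2 ((0 , 1) ∷ []) ((0 , 1) ∷ [])
  stellIn : ∀ {n E A} → MonotoneOuterplanarDAG n E A →
            (p : (Σ ℕ λ s → Σ ℕ λ t → (s , t) ∈ A)) → let s = proj₁ p ; t = proj₁ (proj₂ p) in
            MonotoneOuterplanarDAG (suc n)
              ((s , n) ∷ (t , n) ∷ E)
              ((s , n) ∷ (t , n) ∷ (A ─ proj₂ (proj₂ p)))
  stellOut : ∀ {n E A} → MonotoneOuterplanarDAG n E A →
            (p : (Σ ℕ λ s → Σ ℕ λ t → (s , t) ∈ A)) → let s = proj₁ p ; t = proj₁ (proj₂ p) in
            MonotoneOuterplanarDAG (suc n)
              ((n , s) ∷ (n , t) ∷ E)
              ((n , s) ∷ (n , t) ∷ (A ─ proj₂ (proj₂ p)))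

record VertexOrder (n : ℕ) (E : List Edge) : Set where
  field
    rank      : ℕ → ℕ
    injective : ∀ u v → u < n → v < n → rank u ≡ rank v → u ≡ v
    respects  : ∀ {e} → e ∈ E → rank (src e) < rank (tgt e)

open VertexOrder public

record Twist {n : ℕ} {E : List Edge} (σ : VertexOrder n E) (k : ℕ) : Set where
  field
    edge     : Fin k → Edge
    inE      : ∀ i → edge i ∈ E
    disjoint : ∀ i j → i ≢ j →
               (src (edge i) ≢ src (edge j)) × (src (edge i) ≢ tgt (edge j)) ×
               (tgt (edge i) ≢ src (edge j)) × (tgt (edge i) ≢ tgt (edge j))
    srcs<    : ∀ i j → i F.< j → rank σ (src (edge i)) < rank σ (src (edge j))
    tgts<    : ∀ i j → i F.< j → rank σ (tgt (edge i)) < rank σ (tgt (edge j))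
    src<tgt  : ∀ i j → rank σ (src (edge i)) < rank σ (tgt (edge j))

module Submission where

-- The order is built along the stellation sequence: a new sink x is placed
-- immediately after t, a new source x immediately before s.  Alongside the
-- 5-twist we keep out of the order a whole family of patterns: sequences of
-- vertices increasing in the order, with prescribed edges of which some must be
-- still available (on the outer face, not yet stellated).  An occurrence of a
-- family member after a step that uses x at position p is pulled back to an
-- occurrence before the step, either by replacing x by t (resp. s) or, when t
-- (resp. s) sits at the adjacent position, by merging the two positions; the
-- edges at x then all become copies of the available edge st.  The family is
-- closed under these reductions, up to containing another member or forcing
-- a vertex with three neighbours along the outer cycle; this is certified by a
-- list of hints checked by evaluation.

open import Defs
open import Data.Bool using (true; false; T; if_then_else_)
open import Function using (_∘_; id)
open import Data.Empty using (⊥; ⊥-elim)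
open import Data.List using (List; []; _∷_; _++_; map; filter; head; drop)
open import Data.List.Membership.Propositional using (_∈_; _∉_; find)
open import Data.List.Membership.Propositional.Properties using (∈-++⁺ˡ; ∈-++⁺ʳ; ∈-++⁻; ∈-map⁻; ∈-filter⁻)
open import Data.List.Relation.Unary.All as All using (All; all?; []; _∷_)
open import Data.List.Relation.Unary.All.Properties using (─⁺)
open import Data.List.Relation.Unary.Any using (Any; here; there; any?; _─_)
open import Data.List.Relation.Unary.AllPairs using ([]; _∷_)
open import Data.List.Relation.Unary.Unique.Propositional using (Unique)
import Data.Maybe.Relation.Unary.Any as Maybe
open import Data.Fin using (#_)
open import Data.Nat using (ℕ; zero; suc; pred; _<_; _≤_; _≟_; _<?_; _≤?_; _≡ᵇ_; z≤n; s≤s)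
open import Data.Nat.Properties
open import Data.Product as Product using (Σ; ∃; ∃₂; _×_; _,_; proj₁; proj₂)
open import Data.Sum as Sum using (_⊎_; inj₁; inj₂; [_,_]′; swap)
open import Relation.Binary.Definitions using (DecidableEquality; tri<; tri≈; tri>)
open import Relation.Binary.PropositionalEquality
open import Relation.Nullary using (¬_; Dec; yes; no)
open import Relation.Nullary.Decidable using (_×-dec_; _⊎-dec_; ¬?; map′; toWitness)

-- Positions and ranks

punchIn : ℕ → ℕ → ℕ
punchIn p m with p ≤? m
... | yes _ = suc m
... | no  _ = m

punchIn-≥ : ∀ {p m} → p ≤ m → punchIn p m ≡ suc m
punchIn-≥ {p} {m} p≤m with p ≤? m
... | yes _   = refl
... | no  p≰m = ⊥-elim (p≰m p≤m)

punchIn-< : ∀ {p m} → m < p → punchIn p m ≡ m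
punchIn-< {p} {m} m<p with p ≤? m
... | yes p≤m = ⊥-elim (<⇒≱ m<p p≤m)
... | no  _   = refl

punchIn-≤ : ∀ p m → punchIn p m ≤ suc m
punchIn-≤ p m with p ≤? m
... | yes _ = ≤-refl
... | no  _ = n≤1+n m

punchIn-≢ : ∀ p m → punchIn p m ≢ p
punchIn-≢ p m eq with p ≤? m
... | yes p≤m = 1+n≰n (subst (_≤ m) (sym eq) p≤m)
... | no  p≰m = p≰m (subst (_≤ m) eq ≤-refl)

punchIn-mono-< : ∀ p {a b} → a < b → punchIn p a < punchIn p b
punchIn-mono-< p {a} {b} a<b with p ≤? a | p ≤? b
... | yes _   | yes _   = s≤s a<b
... | yes p≤a | no  p≰b = ⊥-elim (p≰b (≤-trans p≤a (<⇒≤ a<b)))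
... | no  _   | yes _   = m≤n⇒m≤1+n a<b
... | no  _   | no  _   = a<b

punchIn-cancel-< : ∀ p {a b} → punchIn p a < punchIn p b → a < b
punchIn-cancel-< p {a} {b} lt with <-cmp a b
... | tri< a<b _ _ = a<b
... | tri≈ _ refl _ = ⊥-elim (<-irrefl refl lt)
... | tri> _ _ b<a = ⊥-elim (<-asym lt (punchIn-mono-< p b<a))

punchIn-injective : ∀ p {a b} → punchIn p a ≡ punchIn p b → a ≡ b
punchIn-injective p {a} {b} eq with <-cmp a b
... | tri< a<b _ _ = ⊥-elim (<⇒≢ (punchIn-mono-< p a<b) eq)
... | tri≈ _ a≡b _ = a≡b
... | tri> _ _ b<a = ⊥-elim (<⇒≢ (punchIn-mono-< p b<a) (sym eq))

punchOut : ℕ → ℕ → ℕ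
punchOut p v with v <? p
... | yes _ = v
... | no  _ = pred v

punchIn-punchOut : ∀ {p v} → v ≢ p → punchIn p (punchOut p v) ≡ v
punchIn-punchOut {p} {v} v≢p with v <? p
... | yes v<p = punchIn-< v<p
... | no  v≮p with v
...   | zero  = ⊥-elim (v≢p (sym (n≤0⇒n≡0 (≮⇒≥ v≮p))))
...   | suc w = punchIn-≥ (≤-pred (≤∧≢⇒< (≮⇒≥ v≮p) (v≢p ∘ sym)))

insertRank : ℕ → ℕ → (ℕ → ℕ) → ℕ → ℕ
insertRank n p₀ rk v with v ≟ n
... | yes _ = p₀
... | no  _ = punchIn p₀ (rk v)

module InsertRank (n p₀ : ℕ) (rk : ℕ → ℕ) where

  rk′ : ℕ → ℕ
  rk′ = insertRank n p₀ rk

  rk′-new : rk′ n ≡ p₀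
  rk′-new with n ≟ n
  ... | yes _   = refl
  ... | no  n≢n = ⊥-elim (n≢n refl)

  rk′-old : ∀ {v} → v < n → rk′ v ≡ punchIn p₀ (rk v)
  rk′-old {v} v<n with v ≟ n
  ... | yes refl = ⊥-elim (<-irrefl refl v<n)
  ... | no  _    = refl

  <-old⁻ : ∀ {u v} → u < n → v < n → rk′ u < rk′ v → rk u < rk v
  <-old⁻ u<n v<n lt = punchIn-cancel-< p₀ (subst₂ _<_ (rk′-old u<n) (rk′-old v<n) lt)

  <-old⁺ : ∀ {u v} → u < n → v < n → rk u < rk v → rk′ u < rk′ v
  <-old⁺ u<n v<n lt = subst₂ _<_ (sym (rk′-old u<n)) (sym (rk′-old v<n)) (punchIn-mono-< p₀ lt)

  <-new⁻ : ∀ {v} → v < n → rk′ v < rk′ n → rk v < p₀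
  <-new⁻ {v} v<n lt with rk v <? p₀
  ... | yes r<p = r<p
  ... | no  r≮p = ⊥-elim (<⇒≱ (subst₂ _<_ (trans (rk′-old v<n) (punchIn-≥ (≮⇒≥ r≮p))) rk′-new lt)
                               (≤-trans (≮⇒≥ r≮p) (n≤1+n _)))

  >-new⁻ : ∀ {v} → v < n → rk′ n < rk′ v → p₀ ≤ rk v
  >-new⁻ {v} v<n lt with p₀ ≤? rk v
  ... | yes p≤r = p≤r
  ... | no  p≰r = ⊥-elim (<-asym (subst₂ _<_ rk′-new (trans (rk′-old v<n) (punchIn-< (≰⇒> p≰r))) lt) (≰⇒> p≰r))

  <-new⁺ : ∀ {v} → v < n → rk v < p₀ → rk′ v < rk′ n
  <-new⁺ v<n r<p = subst₂ _<_ (sym (trans (rk′-old v<n) (punchIn-< r<p))) (sym rk′-new) r<p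

  >-new⁺ : ∀ {v} → v < n → p₀ ≤ rk v → rk′ n < rk′ v
  >-new⁺ v<n p≤r = subst₂ _<_ (sym rk′-new) (sym (trans (rk′-old v<n) (punchIn-≥ p≤r))) (s≤s p≤r)

  rk′-injective : (∀ u v → u < n → v < n → rk u ≡ rk v → u ≡ v) →
                  ∀ u v → u < suc n → v < suc n → rk′ u ≡ rk′ v → u ≡ v
  rk′-injective rk-inj u v u<1+n v<1+n eq with m≤n⇒m<n∨m≡n (≤-pred u<1+n) | m≤n⇒m<n∨m≡n (≤-pred v<1+n)
  ... | inj₂ refl | inj₂ refl = refl
  ... | inj₂ refl | inj₁ v<n  = ⊥-elim (punchIn-≢ p₀ (rk v) (trans (sym (rk′-old v<n)) (trans (sym eq) rk′-new)))
  ... | inj₁ u<n  | inj₂ refl = ⊥-elim (punchIn-≢ p₀ (rk u) (trans (sym (rk′-old u<n)) (trans eq rk′-new)))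
  ... | inj₁ u<n  | inj₁ v<n  =
    rk-inj u v u<n v<n (punchIn-injective p₀ (trans (sym (rk′-old u<n)) (trans eq (rk′-old v<n))))

_[_≔_] : (ℕ → ℕ) → ℕ → ℕ → ℕ → ℕ
(φ [ p ≔ x ]) j = if j ≡ᵇ p then x else φ j

update-≡ : ∀ {φ p x} → (φ [ p ≔ x ]) p ≡ x
update-≡ {p = p} with p ≡ᵇ p in p≡ᵇp
... | true  = refl
... | false = ⊥-elim (subst T p≡ᵇp (≡⇒≡ᵇ p p refl))

update-≢ : ∀ {φ p x j} → j ≢ p → (φ [ p ≔ x ]) j ≡ φ j
update-≢ {p = p} {j = j} j≢p with j ≡ᵇ p in j≡ᵇp
... | true  = ⊥-elim (j≢p (≡ᵇ⇒≡ j p (subst T (sym j≡ᵇp) _)))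
... | false = refl

bounded-search : ∀ (P : ℕ → Set) → (∀ p → Dec (P p)) → ∀ K →
                 (∃ λ p → p < K × P p) ⊎ (∀ {p} → p < K → ¬ P p)
bounded-search P P? zero = inj₂ λ ()
bounded-search P P? (suc K) with bounded-search P P? K | P? K
... | inj₁ (p , p<K , Pp) | _      = inj₁ (p , m<n⇒m<1+n p<K , Pp)
... | inj₂ _              | yes PK = inj₁ (K , n<1+n K , PK)
... | inj₂ none           | no ¬PK = inj₂ λ p<1+K → below (m≤n⇒m<n∨m≡n (≤-pred p<1+K))
  where
  below : ∀ {p} → p < K ⊎ p ≡ K → ¬ P p
  below (inj₁ p<K)  = none p<K
  below (inj₂ refl) = ¬PK

∈-─⁻ : ∀ {A : Set} {x y : A} {xs} (x∈xs : x ∈ xs) → y ∈ (xs ─ x∈xs) → y ∈ xs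
∈-─⁻ (here refl) y∈     = there y∈
∈-─⁻ (there x∈) (here refl) = here refl
∈-─⁻ (there x∈) (there y∈)  = there (∈-─⁻ x∈ y∈)

∉-─ : ∀ {A : Set} {x : A} {xs} → Unique xs → (x∈xs : x ∈ xs) → x ∉ (xs ─ x∈xs)
∉-─ (x≢ ∷ _) (here refl) x∈       = All.lookup x≢ x∈ refl
∉-─ (y≢ ∷ _) (there x∈) (here refl) = All.lookup y≢ x∈ refl
∉-─ (_ ∷ u) (there x∈) (there x∈′)  = ∉-─ u x∈ x∈′

unique-─ : ∀ {A : Set} {x : A} {xs} → Unique xs → (x∈xs : x ∈ xs) → Unique (xs ─ x∈xs)
unique-─ (_ ∷ u)  (here refl) = u
unique-─ (y≢ ∷ u) (there x∈)  = ─⁺ x∈ y≢ ∷ unique-─ u x∈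

∈-stellIn⁻ : ∀ {s t n u v} {L : List Edge} → (u , v) ∈ (s , n) ∷ (t , n) ∷ L → v ≢ n → (u , v) ∈ L
∈-stellIn⁻ (here refl)         v≢n = ⊥-elim (v≢n refl)
∈-stellIn⁻ (there (here refl)) v≢n = ⊥-elim (v≢n refl)
∈-stellIn⁻ (there (there uv∈)) _   = uv∈

∈-stellOut⁻ : ∀ {s t n u v} {L : List Edge} → (u , v) ∈ (n , s) ∷ (n , t) ∷ L → u ≢ n → (u , v) ∈ L
∈-stellOut⁻ (here refl)         u≢n = ⊥-elim (u≢n refl)
∈-stellOut⁻ (there (here refl)) u≢n = ⊥-elim (u≢n refl)
∈-stellOut⁻ (there (there uv∈)) _   = uv∈

any-head-drop : ∀ {X : Set} {P : X → Set} j xs → Maybe.Any P (head (drop j xs)) → Any P xs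
any-head-drop zero    []       ()
any-head-drop zero    (x ∷ xs) (Maybe.just px) = here px
any-head-drop (suc j) []       ()
any-head-drop (suc j) (x ∷ xs) px = there (any-head-drop j xs px)

-- Outer-face neighbours

Neighbour : List Edge → ℕ → ℕ → Set
Neighbour L v u = (v , u) ∈ L ⊎ (u , v) ∈ L

AtMostTwoNeighbours : List Edge → Set
AtMostTwoNeighbours L = ∀ v → ∃₂ λ a b → ∀ {u} → Neighbour L v u → u ≡ a ⊎ u ≡ b

no-three-among-two : ∀ {x y z a b : ℕ} → x ≡ a ⊎ x ≡ b → y ≡ a ⊎ y ≡ b → z ≡ a ⊎ z ≡ b →
                     x ≢ y → x ≢ z → y ≢ z → ⊥
no-three-among-two (inj₁ refl) (inj₁ refl) _           x≢y _   _   = x≢y refl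
no-three-among-two (inj₁ refl) (inj₂ refl) (inj₁ refl) _   x≢z _   = x≢z refl
no-three-among-two (inj₁ refl) (inj₂ refl) (inj₂ refl) _   _   y≢z = y≢z refl
no-three-among-two (inj₂ refl) (inj₁ refl) (inj₁ refl) _   _   y≢z = y≢z refl
no-three-among-two (inj₂ refl) (inj₁ refl) (inj₂ refl) _   x≢z _   = x≢z refl
no-three-among-two (inj₂ refl) (inj₂ refl) _           x≢y _   _   = x≢y refl

remaining-neighbour : ∀ {L v w} → AtMostTwoNeighbours L → Neighbour L v w →
                      ∃ λ c → ∀ {u} → Neighbour L v u → u ≢ w → u ≡ c
remaining-neighbour {v = v} two v~w with two v
... | a , b , only with only v~w
...   | inj₁ refl = b , λ v~u u≢a → [ (λ u≡a → ⊥-elim (u≢a u≡a)) , id ]′ (only v~u)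
...   | inj₂ refl = a , λ v~u u≢b → [ id , (λ u≡b → ⊥-elim (u≢b u≡b)) ]′ (only v~u)

neighbour-stellIn⁻ : ∀ {s t n L v u} → Neighbour ((s , n) ∷ (t , n) ∷ L) v u →
                     (v ≡ s ⊎ v ≡ t) × u ≡ n ⊎ v ≡ n × (u ≡ s ⊎ u ≡ t) ⊎ Neighbour L v u
neighbour-stellIn⁻ (inj₁ (here refl))         = inj₁ (inj₁ refl , refl)
neighbour-stellIn⁻ (inj₁ (there (here refl))) = inj₁ (inj₂ refl , refl)
neighbour-stellIn⁻ (inj₁ (there (there vu)))  = inj₂ (inj₂ (inj₁ vu))
neighbour-stellIn⁻ (inj₂ (here refl))         = inj₂ (inj₁ (refl , inj₁ refl))
neighbour-stellIn⁻ (inj₂ (there (here refl))) = inj₂ (inj₁ (refl , inj₂ refl))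
neighbour-stellIn⁻ (inj₂ (there (there uv)))  = inj₂ (inj₂ (inj₂ uv))

neighbour-stellOut⇒stellIn : ∀ {s t n L v u} → Neighbour ((n , s) ∷ (n , t) ∷ L) v u →
                             Neighbour ((s , n) ∷ (t , n) ∷ L) v u
neighbour-stellOut⇒stellIn (inj₁ vu) = flip vu
  where
  flip : ∀ {s t n L v u} → (v , u) ∈ (n , s) ∷ (n , t) ∷ L → Neighbour ((s , n) ∷ (t , n) ∷ L) v u
  flip (here refl)         = inj₂ (here refl)
  flip (there (here refl)) = inj₂ (there (here refl))
  flip (there (there vu))  = inj₁ (there (there vu))
neighbour-stellOut⇒stellIn (inj₂ uv) = swap (neighbour-stellOut⇒stellIn (inj₁ uv))

module _ {A : List Edge} {s t n : ℕ} (two : AtMostTwoNeighbours A) (unique : Unique A)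
         (st∈A : (s , t) ∈ A) (ts∉A : (t , s) ∉ A)
         (fresh : ∀ {v u} → Neighbour A v u → v ≢ n) where

  private
    A⁻ : List Edge
    A⁻ = A ─ st∈A

    shrink : ∀ {v u} → Neighbour A⁻ v u → Neighbour A v u
    shrink = Sum.map (∈-─⁻ st∈A) (∈-─⁻ st∈A)

    s≁t : ¬ Neighbour A⁻ s t
    s≁t (inj₁ st∈) = ∉-─ unique st∈A st∈
    s≁t (inj₂ ts∈) = ts∉A (∈-─⁻ st∈A ts∈)

    other : ∀ {v w} → Neighbour A v w → ¬ Neighbour A⁻ v w → ∃ λ c → ∀ {u} → Neighbour A⁻ v u → u ≡ c
    other v~w v≁w with remaining-neighbour two v~w
    ... | c , only = c , λ v~u → only (shrink v~u) (λ { refl → v≁w v~u })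

    s≢n : s ≢ n
    s≢n = fresh (inj₁ st∈A)

    t≢n : t ≢ n
    t≢n = fresh (inj₂ st∈A)

  atMostTwoNeighbours-stellIn : AtMostTwoNeighbours ((s , n) ∷ (t , n) ∷ A⁻)
  atMostTwoNeighbours-stellIn v with v ≟ n | v ≟ s | v ≟ t
  ... | yes refl | _ | _ = s , t , λ n~u → at-new (neighbour-stellIn⁻ n~u)
    where
    at-new : ∀ {u} → (n ≡ s ⊎ n ≡ t) × u ≡ n ⊎ n ≡ n × (u ≡ s ⊎ u ≡ t) ⊎ Neighbour A⁻ n u → u ≡ s ⊎ u ≡ t
    at-new (inj₁ (inj₁ n≡s , _))  = ⊥-elim (s≢n (sym n≡s))
    at-new (inj₁ (inj₂ n≡t , _))  = ⊥-elim (t≢n (sym n≡t))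
    at-new (inj₂ (inj₁ (_ , u∈))) = u∈
    at-new (inj₂ (inj₂ n~u))      = ⊥-elim (fresh (shrink n~u) refl)
  ... | no _ | yes refl | _ = n , c , λ s~u → at-s (neighbour-stellIn⁻ s~u)
    where
    c = proj₁ (other (inj₁ st∈A) s≁t)
    at-s : ∀ {u} → (s ≡ s ⊎ s ≡ t) × u ≡ n ⊎ s ≡ n × (u ≡ s ⊎ u ≡ t) ⊎ Neighbour A⁻ s u → u ≡ n ⊎ u ≡ c
    at-s (inj₁ (_ , u≡n))       = inj₁ u≡n
    at-s (inj₂ (inj₁ (s≡n , _))) = ⊥-elim (s≢n s≡n)
    at-s (inj₂ (inj₂ s~u))      = inj₂ (proj₂ (other (inj₁ st∈A) s≁t) s~u)
  ... | no _ | no _ | yes refl = n , c , λ t~u → at-t (neighbour-stellIn⁻ t~u)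
    where
    c = proj₁ (other (inj₂ st∈A) (s≁t ∘ swap))
    at-t : ∀ {u} → (t ≡ s ⊎ t ≡ t) × u ≡ n ⊎ t ≡ n × (u ≡ s ⊎ u ≡ t) ⊎ Neighbour A⁻ t u → u ≡ n ⊎ u ≡ c
    at-t (inj₁ (_ , u≡n))       = inj₁ u≡n
    at-t (inj₂ (inj₁ (t≡n , _))) = ⊥-elim (t≢n t≡n)
    at-t (inj₂ (inj₂ t~u))      = inj₂ (proj₂ (other (inj₂ st∈A) (s≁t ∘ swap)) t~u)
  ... | no v≢n | no v≢s | no v≢t = a , b , λ v~u → elsewhere (neighbour-stellIn⁻ v~u)
    where
    a = proj₁ (two v)
    b = proj₁ (proj₂ (two v))
    elsewhere : ∀ {u} → (v ≡ s ⊎ v ≡ t) × u ≡ n ⊎ v ≡ n × (u ≡ s ⊎ u ≡ t) ⊎ Neighbour A⁻ v u → u ≡ a ⊎ u ≡ b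
    elsewhere (inj₁ (inj₁ v≡s , _)) = ⊥-elim (v≢s v≡s)
    elsewhere (inj₁ (inj₂ v≡t , _)) = ⊥-elim (v≢t v≡t)
    elsewhere (inj₂ (inj₁ (v≡n , _))) = ⊥-elim (v≢n v≡n)
    elsewhere (inj₂ (inj₂ v~u))    = proj₂ (proj₂ (two v)) (shrink v~u)

  atMostTwoNeighbours-stellOut : AtMostTwoNeighbours ((n , s) ∷ (n , t) ∷ A⁻)
  atMostTwoNeighbours-stellOut v with atMostTwoNeighbours-stellIn v
  ... | a , b , only = a , b , only ∘ neighbour-stellOut⇒stellIn

-- Patterns

record Pattern : Set where
  constructor mkPattern
  field
    size      : ℕ
    edges     : List Edge
    available : List Edge

open Pattern

allEdges : Pattern → List Edge
allEdges P = edges P ++ available P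

WellFormed : Pattern → Set
WellFormed P = All (λ e → src e < tgt e × tgt e < size P) (allEdges P)

record Embedding (n : ℕ) (E A : List Edge) (rk : ℕ → ℕ) (P : Pattern) (φ : ℕ → ℕ) : Set where
  field
    bounded    : ∀ {i} → i < size P → φ i < n
    increasing : ∀ {i} → suc i < size P → rk (φ i) < rk (φ (suc i))
    edges⁺     : ∀ {a b} → (a , b) ∈ edges P → (φ a , φ b) ∈ E
    available⁺ : ∀ {a b} → (a , b) ∈ available P → (φ a , φ b) ∈ A

  increasing-< : ∀ {i j} → i < j → j < size P → rk (φ i) < rk (φ j)
  increasing-< {i} {suc j} i<1+j 1+j<k with m≤n⇒m<n∨m≡n (≤-pred i<1+j)
  ... | inj₁ i<j  = <-trans (increasing-< i<j (<-trans (n<1+n j) 1+j<k)) (increasing 1+j<k)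
  ... | inj₂ refl = increasing 1+j<k

  distinct : ∀ {i j} → i < size P → j < size P → i ≢ j → φ i ≢ φ j
  distinct {i} {j} i<k j<k i≢j φi≡φj with <-cmp i j
  ... | tri< i<j _ _ = <⇒≢ (increasing-< i<j j<k) (cong rk φi≡φj)
  ... | tri≈ _ i≡j _ = i≢j i≡j
  ... | tri> _ _ j<i = <⇒≢ (increasing-< j<i i<k) (cong rk (sym φi≡φj))

_⊑_ : Pattern → Pattern → Set
R ⊑ Q = size R ≡ size Q × All (_∈ edges Q) (edges R) × All (_∈ available Q) (available R)

embedding-⊑ : ∀ {n E A rk R Q φ} → R ⊑ Q → Embedding n E A rk Q φ → Embedding n E A rk R φ
embedding-⊑ (refl , eR⊆eQ , aR⊆aQ) emb = record
  { bounded    = bounded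
  ; increasing = increasing
  ; edges⁺     = edges⁺ ∘ All.lookup eR⊆eQ
  ; available⁺ = available⁺ ∘ All.lookup aR⊆aQ
  }
  where open Embedding emb


embedding-identity-size : ∀ {n E A P φ} → Embedding n E A (λ v → v) P φ → size P ≤ n
embedding-identity-size {P = P} {φ} emb with size P in size≡
... | zero  = z≤n
... | suc m = ≤-trans (s≤s (position≤ m<k)) (bounded m<k)
  where
  open Embedding emb
  m<k : m < size P
  m<k = subst (m <_) (sym size≡) (n<1+n m)
  position≤ : ∀ {i} → i < size P → i ≤ φ i
  position≤ {zero}  _     = z≤n
  position≤ {suc i} 1+i<k = ≤-trans (s≤s (position≤ (<-trans (n<1+n i) 1+i<k))) (increasing 1+i<k)

twistPattern : Pattern
twistPattern = mkPattern 10 ((0 , 5) ∷ (1 , 6) ∷ (2 , 7) ∷ (3 , 8) ∷ (4 , 9) ∷ []) []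

module _ {n E} {σ : VertexOrder n E} (tw : Twist σ 5) where

  open Twist tw

  twistVertex : ℕ → ℕ
  twistVertex 0 = src (edge (# 0))
  twistVertex 1 = src (edge (# 1))
  twistVertex 2 = src (edge (# 2))
  twistVertex 3 = src (edge (# 3))
  twistVertex 4 = src (edge (# 4))
  twistVertex 5 = tgt (edge (# 0))
  twistVertex 6 = tgt (edge (# 1))
  twistVertex 7 = tgt (edge (# 2))
  twistVertex 8 = tgt (edge (# 3))
  twistVertex 9 = tgt (edge (# 4))
  twistVertex _ = 0

  twist-embedding : ∀ {A} → (∀ {e} → e ∈ E → src e < n × tgt e < n) →
                    Embedding n E A (rank σ) twistPattern twistVertex
  twist-embedding inRange = record
    { bounded    = bounded
    ; increasing = increasing
    ; edges⁺     = λ { (here refl) → inE (# 0) ; (there (here refl)) → inE (# 1)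
                     ; (there (there (here refl))) → inE (# 2) ; (there (there (there (here refl)))) → inE (# 3)
                     ; (there (there (there (there (here refl))))) → inE (# 4) }
    ; available⁺ = λ ()
    }
    where
    src< : ∀ i → src (edge i) < n
    src< i = proj₁ (inRange (inE i))

    tgt< : ∀ i → tgt (edge i) < n
    tgt< i = proj₂ (inRange (inE i))

    bounded : ∀ {i} → i < 10 → twistVertex i < n
    bounded {0} _ = src< (# 0)
    bounded {1} _ = src< (# 1)
    bounded {2} _ = src< (# 2)
    bounded {3} _ = src< (# 3)
    bounded {4} _ = src< (# 4)
    bounded {5} _ = tgt< (# 0)
    bounded {6} _ = tgt< (# 1)
    bounded {7} _ = tgt< (# 2)
    bounded {8} _ = tgt< (# 3)
    bounded {9} _ = tgt< (# 4)
    bounded {suc (suc (suc (suc (suc (suc (suc (suc (suc (suc i)))))))))} i<10 = ⊥-elim (<⇒≱ i<10 (m≤m+n 10 i))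

    increasing : ∀ {i} → suc i < 10 → rank σ (twistVertex i) < rank σ (twistVertex (suc i))
    increasing {0} _ = srcs< (# 0) (# 1) (s≤s z≤n)
    increasing {1} _ = srcs< (# 1) (# 2) (s≤s (s≤s z≤n))
    increasing {2} _ = srcs< (# 2) (# 3) (s≤s (s≤s (s≤s z≤n)))
    increasing {3} _ = srcs< (# 3) (# 4) (s≤s (s≤s (s≤s (s≤s z≤n))))
    increasing {4} _ = src<tgt (# 4) (# 0)
    increasing {5} _ = tgts< (# 0) (# 1) (s≤s z≤n)
    increasing {6} _ = tgts< (# 1) (# 2) (s≤s (s≤s z≤n))
    increasing {7} _ = tgts< (# 2) (# 3) (s≤s (s≤s (s≤s z≤n)))
    increasing {8} _ = tgts< (# 3) (# 4) (s≤s (s≤s (s≤s (s≤s z≤n))))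
    increasing {suc (suc (suc (suc (suc (suc (suc (suc (suc i))))))))} 1+i<10 = ⊥-elim (<⇒≱ 1+i<10 (m≤m+n 10 i))

-- The reductions at the position p of the new vertex: `rename` replaces it by t
-- (sink) or s (source), `merge` identifies it with the adjacent position holding
-- t (sink) or s (source).  Edges at p become copies of the available edge st.

removeIncident : ℕ → List Edge → List Edge
removeIncident p = filter λ e → ¬? (src e ≟ p) ×-dec ¬? (tgt e ≟ p)

redirectTargets : ℕ → ℕ → List Edge → List Edge
redirectTargets p q = map (λ e → src e , q) ∘ filter λ e → tgt e ≟ p ×-dec ¬? (src e ≟ q)

redirectSources : ℕ → ℕ → List Edge → List Edge
redirectSources p q = map (λ e → q , tgt e) ∘ filter λ e → src e ≟ p ×-dec ¬? (tgt e ≟ q)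

punchOutEdges : ℕ → List Edge → List Edge
punchOutEdges p = map λ e → punchOut p (src e) , punchOut p (tgt e)

merge : Pattern → ℕ → List Edge → Pattern
merge P p redirected = mkPattern (pred (size P))
  (punchOutEdges p (removeIncident p (edges P) ++ redirected))
  (punchOutEdges p (removeIncident p (available P) ++ redirected))

mergeSink : Pattern → ℕ → Pattern
mergeSink P p = merge P p (redirectTargets p (pred p) (allEdges P))

mergeSource : Pattern → ℕ → Pattern
mergeSource P p = merge P p (redirectSources p (suc p) (allEdges P))

rename : Pattern → List Edge → Pattern
rename P extra = record P { available = available P ++ extra }

renameSink : Pattern → ℕ → Pattern
renameSink P p = rename P (filter (λ e → tgt e ≟ p) (allEdges P))

renameSource : Pattern → ℕ → Pattern
renameSource P p = rename P (filter (λ e → src e ≟ p) (allEdges P))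

∈-redirectTargets⁻ : ∀ {p q L e} → e ∈ redirectTargets p q L → ∃ λ a → e ≡ (a , q) × (a , p) ∈ L × a ≢ q
∈-redirectTargets⁻ {p} {q} {L} e∈ with ∈-map⁻ _ e∈
... | (a , b) , ab∈ , refl with ∈-filter⁻ (λ e → tgt e ≟ p ×-dec ¬? (src e ≟ q)) {xs = L} ab∈
...   | ab∈L , refl , a≢q = a , refl , ab∈L , a≢q

∈-redirectSources⁻ : ∀ {p q L e} → e ∈ redirectSources p q L → ∃ λ b → e ≡ (q , b) × (p , b) ∈ L × b ≢ q
∈-redirectSources⁻ {p} {q} {L} e∈ with ∈-map⁻ _ e∈
... | (a , b) , ab∈ , refl with ∈-filter⁻ (λ e → src e ≟ p ×-dec ¬? (tgt e ≟ q)) {xs = L} ab∈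
...   | ab∈L , refl , b≢q = b , refl , ab∈L , b≢q

-- Certificates

-- A refutation of an occurrence of a pattern: it contains the j-th member of the
-- family (`contains j`), or it forces position v to have the three distinct
-- neighbours a, b, c along the outer cycle (`overloaded v a b c`).  A hint for
-- position p of a family member refutes the occurrences in which the new vertex
-- sits at p: either p has an edge that a new sink (source) cannot have, or the
-- renamed pattern is refuted and so is the merged one, unless there is no
-- adjacent position or the merged pattern needs the stellated edge st available.

data Refutation : Set where
  contains   : ℕ → Refutation
  overloaded : ℕ → ℕ → ℕ → ℕ → Refutation

Refutes : List Pattern → Pattern → Refutation → Set
Refutes F Q (contains j)         = Maybe.Any (_⊑ Q) (head (drop j F))
Refutes F Q (overloaded v a b c) =
  All (λ u → u < size Q × Neighbour (available Q) v u) (a ∷ b ∷ c ∷ []) × a ≢ b × a ≢ c × b ≢ c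

data Merge : Set where
  atEnd mergedAvailable : Merge
  merged                : Refutation → Merge

data Hint : Set where
  wrongDirection : Hint
  reduce         : Merge → Refutation → Hint

SinkMerge : List Pattern → Pattern → ℕ → Merge → Set
SinkMerge F P p atEnd           = p ≡ 0
SinkMerge F P p mergedAvailable = Any (_∈ available P) (redirectTargets p (pred p) (allEdges P))
SinkMerge F P p (merged r)      = Refutes F (mergeSink P p) r

SinkHint : List Pattern → Pattern → ℕ → Hint → Set
SinkHint F P p wrongDirection = Any (λ e → src e ≡ p) (allEdges P)
SinkHint F P p (reduce m r)   = SinkMerge F P p m × Refutes F (renameSink P p) r

SourceMerge : List Pattern → Pattern → ℕ → Merge → Set
SourceMerge F P p atEnd           = suc p ≡ size P
SourceMerge F P p mergedAvailable = Any (_∈ available P) (redirectSources p (suc p) (allEdges P))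
SourceMerge F P p (merged r)      = Refutes F (mergeSource P p) r

SourceHint : List Pattern → Pattern → ℕ → Hint → Set
SourceHint F P p wrongDirection = Any (λ e → tgt e ≡ p) (allEdges P)
SourceHint F P p (reduce m r)   = SourceMerge F P p m × Refutes F (renameSource P p) r

record Certified (F : List Pattern) : Set where
  field
    wellFormed : ∀ {P} → P ∈ F → WellFormed P
    large      : ∀ {P} → P ∈ F → 2 < size P
    sinkHint   : ∀ {P} → P ∈ F → ∀ {p} → p < size P → ∃ (SinkHint F P p)
    sourceHint : ∀ {P} → P ∈ F → ∀ {p} → p < size P → ∃ (SourceHint F P p)

Entry : Set
Entry = Pattern × List (Hint × Hint)

HintsFrom : List Pattern → Pattern → ℕ → List (Hint × Hint) → Set
HintsFrom F P p []              = p ≡ size P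
HintsFrom F P p ((h , h′) ∷ hs) = (SinkHint F P p h × SourceHint F P p h′) × HintsFrom F P (suc p) hs

ValidEntry : List Pattern → Entry → Set
ValidEntry F (P , hs) = (WellFormed P × 2 < size P) × HintsFrom F P 0 hs

hintsFrom-lookup : ∀ {F P p₀ p} hs → HintsFrom F P p₀ hs → p₀ ≤ p → p < size P →
                   ∃ (SinkHint F P p) × ∃ (SourceHint F P p)
hintsFrom-lookup [] refl p₀≤p p<k = ⊥-elim (<⇒≱ p<k p₀≤p)
hintsFrom-lookup ((h , h′) ∷ hs) ((sink , source) , rest) p₀≤p p<k with m≤n⇒m<n∨m≡n p₀≤p
... | inj₁ p₀<p = hintsFrom-lookup hs rest p₀<p p<k
... | inj₂ refl = (h , sink) , (h′ , source)

certified : ∀ es → All (ValidEntry (map proj₁ es)) es → Certified (map proj₁ es)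
certified es valid = record
  { wellFormed = λ P∈F → proj₁ (proj₁ (proj₂ (entry P∈F)))
  ; large      = λ P∈F → proj₂ (proj₁ (proj₂ (entry P∈F)))
  ; sinkHint   = λ P∈F p<k → proj₁ (hintsFrom-lookup _ (proj₂ (proj₂ (entry P∈F))) z≤n p<k)
  ; sourceHint = λ P∈F p<k → proj₂ (hintsFrom-lookup _ (proj₂ (proj₂ (entry P∈F))) z≤n p<k)
  }
  where
  entry : ∀ {P} → P ∈ map proj₁ es → ∃ λ hs → ValidEntry (map proj₁ es) (P , hs)
  entry P∈F with ∈-map⁻ proj₁ P∈F
  ... | (_ , hs) , P,hs∈es , refl = hs , All.lookup valid P,hs∈es

-- Stellation

module Stellation (F : List Pattern) (certified : Certified F) where

  open Certified certified

  record Good (n : ℕ) (E A : List Edge) : Set where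
    field
      order      : VertexOrder n E
      inRange    : ∀ {e} → e ∈ E → src e < n × tgt e < n
      available⊆ : ∀ {e} → e ∈ A → e ∈ E
      unique     : Unique A
      neighbours : AtMostTwoNeighbours A
      avoids     : ∀ {P} → P ∈ F → ∀ φ → ¬ Embedding n E A (rank order) P φ

    not-reversed : ∀ {s t} → (s , t) ∈ A → (t , s) ∉ A
    not-reversed st∈ ts∈ = <-asym (respects order (available⊆ st∈)) (respects order (available⊆ ts∈))

    neighbour-old : ∀ {v u} → Neighbour A v u → v < n
    neighbour-old (inj₁ vu∈) = proj₁ (inRange (available⊆ vu∈))
    neighbour-old (inj₂ uv∈) = proj₂ (inRange (available⊆ uv∈))

  refute : ∀ {n E A Q ψ} (good : Good n E A) r → Refutes F Q r →
           ¬ Embedding n E A (rank (Good.order good)) Q ψ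
  refute good (contains j) contained emb with find (any-head-drop j F contained)
  ... | R , R∈F , R⊑Q = Good.avoids good R∈F _ (embedding-⊑ R⊑Q emb)
  refute {Q = Q} {ψ} good (overloaded v a b c) ((a-ok ∷ b-ok ∷ c-ok ∷ []) , a≢b , a≢c , b≢c) emb =
    no-three-among-two (at a-ok) (at b-ok) (at c-ok)
      (distinct (proj₁ a-ok) (proj₁ b-ok) a≢b) (distinct (proj₁ a-ok) (proj₁ c-ok) a≢c)
      (distinct (proj₁ b-ok) (proj₁ c-ok) b≢c)
    where
    open Embedding emb
    two = Good.neighbours good (ψ v)
    at : ∀ {u} → u < size Q × Neighbour (available Q) v u → ψ u ≡ proj₁ two ⊎ ψ u ≡ proj₁ (proj₂ two)
    at (_ , v~u) = proj₂ (proj₂ two) (Sum.map available⁺ available⁺ v~u)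

  good-start : Good 2 ((0 , 1) ∷ []) ((0 , 1) ∷ [])
  good-start = record
    { order      = record { rank = λ v → v ; injective = λ _ _ _ _ eq → eq ; respects = λ { (here refl) → s≤s z≤n } }
    ; inRange    = λ { (here refl) → s≤s z≤n , s≤s (s≤s z≤n) }
    ; available⊆ = id
    ; unique     = [] ∷ []
    ; neighbours = λ _ → 0 , 1 , λ { (inj₁ (here refl)) → inj₂ refl ; (inj₂ (here refl)) → inj₁ refl }
    ; avoids     = λ P∈F φ emb → <⇒≱ (large P∈F) (embedding-identity-size emb)
    }

  module NewVertex {n E A} (good : Good n E A) (p₀ : ℕ) {E′ A′ : List Edge}
                   (A′⊆E′ : ∀ {e} → e ∈ A′ → e ∈ E′)
                   (E′-old : ∀ {u v} → (u , v) ∈ E′ → u ≢ n → v ≢ n → (u , v) ∈ E)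
                   (A′-old : ∀ {u v} → (u , v) ∈ A′ → u ≢ n → v ≢ n → (u , v) ∈ A) where

    open Good good
    open InsertRank n p₀ (rank order) public

    module Embedded {P} (P∈F : P ∈ F) {φ} (emb : Embedding (suc n) E′ A′ rk′ P φ) where

      open Embedding emb

      ordered : ∀ {a b} → (a , b) ∈ allEdges P → a < b
      ordered = proj₁ ∘ All.lookup (wellFormed P∈F)

      endpoints : ∀ {a b} → (a , b) ∈ allEdges P → a < size P × b < size P
      endpoints ab∈ = let a<b , b<k = All.lookup (wellFormed P∈F) ab∈ in <-trans a<b b<k , b<k

      image : ∀ {a b} → (a , b) ∈ allEdges P → (φ a , φ b) ∈ E′
      image ab∈ with ∈-++⁻ (edges P) ab∈
      ... | inj₁ ab∈E = edges⁺ ab∈E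
      ... | inj₂ ab∈A = A′⊆E′ (available⁺ ab∈A)

      old : ∀ {i} → i < size P → φ i ≢ n → φ i < n
      old i<k φi≢n = ≤∧≢⇒< (≤-pred (bounded i<k)) φi≢n

      restrict : (∀ {i} → i < size P → φ i ≢ n) → Embedding n E A (rank order) P φ
      restrict φ≢n = record
        { bounded    = λ i<k → old i<k (φ≢n i<k)
        ; increasing = λ {i} 1+i<k → let i<k = <-trans (n<1+n i) 1+i<k in
                         <-old⁻ (old i<k (φ≢n i<k)) (old 1+i<k (φ≢n 1+i<k)) (increasing 1+i<k)
        ; edges⁺     = λ ab∈ → let a<k , b<k = endpoints (∈-++⁺ˡ ab∈) in
                         E′-old (edges⁺ ab∈) (φ≢n a<k) (φ≢n b<k)
        ; available⁺ = λ ab∈ → let a<k , b<k = endpoints (∈-++⁺ʳ (edges P) ab∈) in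
                         A′-old (available⁺ ab∈) (φ≢n a<k) (φ≢n b<k)
        }

      module AtNew {p} (p<k : p < size P) (φp≡n : φ p ≡ n) where

        φ≢n : ∀ {j} → j < size P → j ≢ p → φ j ≢ n
        φ≢n j<k j≢p φj≡n = distinct j<k p<k j≢p (trans φj≡n (sym φp≡n))

        old′ : ∀ {j} → j < size P → j ≢ p → φ j < n
        old′ j<k j≢p = old j<k (φ≢n j<k j≢p)

        keep-edges : ∀ {a b} → (a , b) ∈ edges P → a ≢ p → b ≢ p → (φ a , φ b) ∈ E
        keep-edges ab∈ a≢p b≢p = let a<k , b<k = endpoints (∈-++⁺ˡ ab∈) in
          E′-old (edges⁺ ab∈) (φ≢n a<k a≢p) (φ≢n b<k b≢p)

        keep-available : ∀ {a b} → (a , b) ∈ available P → a ≢ p → b ≢ p → (φ a , φ b) ∈ A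
        keep-available ab∈ a≢p b≢p = let a<k , b<k = endpoints (∈-++⁺ʳ (edges P) ab∈) in
          A′-old (available⁺ ab∈) (φ≢n a<k a≢p) (φ≢n b<k b≢p)

        embedding-rename : ∀ {ψ} extra → ψ p < n → (∀ {j} → j ≢ p → ψ j ≡ φ j) →
                  (∀ {j} → suc j < size P → rank order (ψ j) < rank order (ψ (suc j))) →
                  (∀ {a b} → (a , b) ∈ allEdges P → a ≡ p ⊎ b ≡ p → (ψ a , ψ b) ∈ A) →
                  (∀ {e} → e ∈ extra → e ∈ allEdges P × (src e ≡ p ⊎ tgt e ≡ p)) →
                  Embedding n E A (rank order) (rename P extra) ψ
        embedding-rename {ψ} extra ψp<n ψ≡φ ψ-increasing touching extra-touching = record
          { bounded    = ψ-bounded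
          ; increasing = ψ-increasing
          ; edges⁺     = λ ab∈ → transfer available⊆ (∈-++⁺ˡ ab∈) (keep-edges ab∈)
          ; available⁺ = ψ-available
          }
          where
          ψ-bounded : ∀ {j} → j < size P → ψ j < n
          ψ-bounded {j} j<k with j ≟ p
          ... | yes refl = ψp<n
          ... | no  j≢p  = subst (_< n) (sym (ψ≡φ j≢p)) (old′ j<k j≢p)

          transfer : ∀ {X a b} → (∀ {e} → e ∈ A → e ∈ X) → (a , b) ∈ allEdges P →
                     (a ≢ p → b ≢ p → (φ a , φ b) ∈ X) → (ψ a , ψ b) ∈ X
          transfer {X} {a} {b} A⊆X ab∈ kept with a ≟ p | b ≟ p
          ... | yes a≡p | _        = A⊆X (touching ab∈ (inj₁ a≡p))
          ... | no  _   | yes b≡p  = A⊆X (touching ab∈ (inj₂ b≡p))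
          ... | no  a≢p | no  b≢p  =
            subst₂ (λ u v → (u , v) ∈ X) (sym (ψ≡φ a≢p)) (sym (ψ≡φ b≢p)) (kept a≢p b≢p)

          ψ-available : ∀ {a b} → (a , b) ∈ available P ++ extra → (ψ a , ψ b) ∈ A
          ψ-available ab∈ with ∈-++⁻ (available P) ab∈
          ... | inj₁ ab∈A = transfer id (∈-++⁺ʳ (edges P) ab∈A) (keep-available ab∈A)
          ... | inj₂ ab∈X = let ab∈P , touches = extra-touching ab∈X in touching ab∈P touches

        embedding-merge : ∀ R → (∀ {a b} → (a , b) ∈ R → a ≢ p × b ≢ p × (φ a , φ b) ∈ A) →
                 Embedding n E A (rank order) (merge P p R) (φ ∘ punchIn p)
        embedding-merge R R-ok = record
          { bounded    = λ {j} j<k′ → old′ (punchIn<k j<k′) (punchIn-≢ p j)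
          ; increasing = λ {j} 1+j<k′ →
              <-old⁻ (old′ (punchIn<k (<-trans (n<1+n j) 1+j<k′)) (punchIn-≢ p j))
                     (old′ (punchIn<k 1+j<k′) (punchIn-≢ p (suc j)))
                     (increasing-< (punchIn-mono-< p (n<1+n j)) (punchIn<k 1+j<k′))
          ; edges⁺     = moved (edges P) keep-edges available⊆
          ; available⁺ = moved (available P) keep-available id
          }
          where
          punchIn<k : ∀ {j} → j < pred (size P) → punchIn p j < size P
          punchIn<k {j} j<k′ = ≤-<-trans (punchIn-≤ p j) (pred-cancel-< j<k′)

          moved : ∀ {X} L → (∀ {a b} → (a , b) ∈ L → a ≢ p → b ≢ p → (φ a , φ b) ∈ X) →
                  (∀ {e} → e ∈ A → e ∈ X) →
                  ∀ {a b} → (a , b) ∈ punchOutEdges p (removeIncident p L ++ R) →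
                  (φ (punchIn p a) , φ (punchIn p b)) ∈ X
          moved {X} L kept A⊆X ab∈ with ∈-map⁻ _ ab∈
          ... | (a₀ , b₀) , ab₀∈ , refl with ∈-++⁻ (removeIncident p L) ab₀∈
          ...   | inj₁ ab₀∈L′ with ∈-filter⁻ (λ e → ¬? (src e ≟ p) ×-dec ¬? (tgt e ≟ p)) {xs = L} ab₀∈L′
          ...     | ab₀∈L , a₀≢p , b₀≢p =
            subst₂ (λ u v → (φ u , φ v) ∈ X) (sym (punchIn-punchOut a₀≢p)) (sym (punchIn-punchOut b₀≢p))
                   (kept ab₀∈L a₀≢p b₀≢p)
          moved {X} L kept A⊆X ab∈ | (a₀ , b₀) , ab₀∈ , refl | inj₂ ab₀∈R with R-ok ab₀∈R
          ... | a₀≢p , b₀≢p , φab∈A =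
            subst₂ (λ u v → (φ u , φ v) ∈ X) (sym (punchIn-punchOut a₀≢p)) (sym (punchIn-punchOut b₀≢p))
                   (A⊆X φab∈A)

  module SinkStep {n E A} (good : Good n E A) {s t} (st∈A : (s , t) ∈ A) where

    open Good good

    E′ A′ : List Edge
    E′ = (s , n) ∷ (t , n) ∷ E
    A′ = (s , n) ∷ (t , n) ∷ (A ─ st∈A)

    private
      rk : ℕ → ℕ
      rk = rank order

      st∈E : (s , t) ∈ E
      st∈E = available⊆ st∈A

      s<n : s < n
      s<n = proj₁ (inRange st∈E)

      t<n : t < n
      t<n = proj₂ (inRange st∈E)

      s<t : rk s < rk t
      s<t = respects order st∈E

    A′⊆E′ : ∀ {e} → e ∈ A′ → e ∈ E′
    A′⊆E′ (here refl)         = here refl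
    A′⊆E′ (there (here refl)) = there (here refl)
    A′⊆E′ (there (there e∈))  = there (there (available⊆ (∈-─⁻ st∈A e∈)))

    from-s-or-t : ∀ {u} → (u , n) ∈ E′ → u ≡ s ⊎ u ≡ t
    from-s-or-t (here refl)         = inj₁ refl
    from-s-or-t (there (here refl)) = inj₂ refl
    from-s-or-t (there (there un∈)) = ⊥-elim (<-irrefl refl (proj₂ (inRange un∈)))

    no-edge-from-new : ∀ {v} → (n , v) ∉ E′
    no-edge-from-new (here refl)         = <-irrefl refl s<n
    no-edge-from-new (there (here refl)) = <-irrefl refl t<n
    no-edge-from-new (there (there nv∈)) = <-irrefl refl (proj₁ (inRange nv∈))

    st∉A′ : (s , t) ∉ A′
    st∉A′ (here refl)         = <-irrefl refl t<n
    st∉A′ (there (here refl)) = <-irrefl refl t<n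
    st∉A′ (there (there st∈)) = ∉-─ unique st∈A st∈

    open NewVertex good (suc (rk t)) A′⊆E′ (λ uv∈ _ v≢n → ∈-stellIn⁻ uv∈ v≢n)
                                          (λ uv∈ _ v≢n → ∈-─⁻ st∈A (∈-stellIn⁻ uv∈ v≢n))

    module _ {P} (P∈F : P ∈ F) {φ} (emb : Embedding (suc n) E′ A′ rk′ P φ) where

      open Embedding emb
      open Embedded P∈F emb

      module _ {p} (p<k : p < size P) (φp≡n : φ p ≡ n) where

        open AtNew p<k φp≡n

        no-edge-from-p : ∀ {b} → (p , b) ∉ allEdges P
        no-edge-from-p {b} pb∈ = no-edge-from-new (subst (λ x → (x , φ b) ∈ E′) φp≡n (image pb∈))

        wrongDirection-absurd : ¬ Any (λ e → src e ≡ p) (allEdges P)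
        wrongDirection-absurd out with find out
        ... | _ , pb∈ , refl = no-edge-from-p pb∈

        source-of : ∀ {a} → (a , p) ∈ allEdges P → φ a ≡ s ⊎ φ a ≡ t
        source-of {a} ap∈ = from-s-or-t (subst (λ x → (φ a , x) ∈ E′) φp≡n (image ap∈))

        embedding-renameSink : (∀ {a} → a < p → rk (φ a) < rk t) →
                               Embedding n E A rk (renameSink P p) (φ [ p ≔ t ])
        embedding-renameSink below = embedding-rename _ (subst (_< n) (sym ψp≡t) t<n) ψ≡φ
          ψ-increasing touching extra-touching
          where
          ψ : ℕ → ℕ
          ψ = φ [ p ≔ t ]

          ψp≡t : ψ p ≡ t
          ψp≡t = update-≡ {φ} {p}

          ψ≡φ : ∀ {j} → j ≢ p → ψ j ≡ φ j
          ψ≡φ = update-≢ {φ} {p}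

          ψ-increasing : ∀ {j} → suc j < size P → rk (ψ j) < rk (ψ (suc j))
          ψ-increasing {j} 1+j<k with j ≟ p
          ... | yes refl =
            subst₂ (λ u v → rk u < rk v) (sym ψp≡t) (sym (ψ≡φ 1+n≢n))
              (>-new⁻ (old′ 1+j<k 1+n≢n) (subst (λ x → rk′ x < rk′ (φ (suc p))) φp≡n (increasing 1+j<k)))
          ... | no j≢p with suc j ≟ p
          ...   | yes refl =
            subst₂ (λ u v → rk u < rk v) (sym (ψ≡φ j≢p)) (sym ψp≡t) (below (n<1+n j))
          ...   | no 1+j≢p =
            subst₂ (λ u v → rk u < rk v) (sym (ψ≡φ j≢p)) (sym (ψ≡φ 1+j≢p))
              (<-old⁻ (old′ (<-trans (n<1+n j) 1+j<k) j≢p) (old′ 1+j<k 1+j≢p) (increasing 1+j<k))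

          touching : ∀ {a b} → (a , b) ∈ allEdges P → a ≡ p ⊎ b ≡ p → (ψ a , ψ b) ∈ A
          touching ab∈ (inj₁ refl) = ⊥-elim (no-edge-from-p ab∈)
          touching {a} ab∈ (inj₂ refl) with source-of ab∈
          ... | inj₁ φa≡s = subst₂ (λ u v → (u , v) ∈ A) (sym (trans (ψ≡φ (<⇒≢ (ordered ab∈))) φa≡s))
                                   (sym ψp≡t) st∈A
          ... | inj₂ φa≡t = ⊥-elim (<-irrefl (cong rk φa≡t) (below (ordered ab∈)))

          extra-touching : ∀ {e} → e ∈ filter (λ e → tgt e ≟ p) (allEdges P) → e ∈ allEdges P × (src e ≡ p ⊎ tgt e ≡ p)
          extra-touching e∈ = Product.map₂ inj₂ (∈-filter⁻ (λ e → tgt e ≟ p) {xs = allEdges P} e∈)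

        last-before-new : ∀ {q} → p ≡ suc q → φ q ≢ t → rk (φ q) < rk t
        last-before-new {q} refl φq≢t =
          ≤∧≢⇒< (≤-pred (<-new⁻ φq<n (subst (λ x → rk′ (φ q) < rk′ x) φp≡n (increasing p<k))))
                (φq≢t ∘ injective order _ _ φq<n t<n)
          where
          φq<n : φ q < n
          φq<n = old′ (<-trans (n<1+n q) p<k) (<⇒≢ (n<1+n q))

        below-t : ∀ {q} → p ≡ suc q → φ q ≢ t → ∀ {a} → a < p → rk (φ a) < rk t
        below-t {q} refl φq≢t {a} a<p with m≤n⇒m<n∨m≡n (≤-pred a<p)
        ... | inj₁ a<q  = <-trans (<-old⁻ (old′ (<-trans a<p p<k) (<⇒≢ a<p)) (old′ q<k (<⇒≢ (n<1+n q)))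
                                          (increasing-< a<q q<k))
                                  (last-before-new refl φq≢t)
          where q<k = <-trans (n<1+n q) p<k
        ... | inj₂ refl = last-before-new refl φq≢t

        module _ {q} (p≡1+q : p ≡ suc q) (φq≡t : φ q ≡ t) where

          redirected-from-s : ∀ {a} → (a , p) ∈ allEdges P → a ≢ q → φ a ≡ s
          redirected-from-s ap∈ a≢q with source-of ap∈
          ... | inj₁ φa≡s = φa≡s
          ... | inj₂ φa≡t = ⊥-elim (distinct (proj₁ (endpoints ap∈)) q<k a≢q (trans φa≡t (sym φq≡t)))
            where q<k = <-trans (n<1+n q) (subst (_< size P) p≡1+q p<k)

          redirected : ∀ {e} → e ∈ redirectTargets p q (allEdges P) → (φ (src e) , φ (tgt e)) ≡ (s , t)
          redirected e∈ with ∈-redirectTargets⁻ e∈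
          ... | a , refl , ap∈ , a≢q = cong₂ _,_ (redirected-from-s ap∈ a≢q) φq≡t

          no-merged-available : ¬ Any (_∈ available P) (redirectTargets p q (allEdges P))
          no-merged-available found with find found
          ... | e , e∈R , e∈available = st∉A′ (subst (_∈ A′) (redirected e∈R) (available⁺ e∈available))

          embedding-mergeSink : Embedding n E A rk (merge P p (redirectTargets p q (allEdges P))) (φ ∘ punchIn p)
          embedding-mergeSink = embedding-merge _ R-ok
            where
            R-ok : ∀ {a b} → (a , b) ∈ redirectTargets p q (allEdges P) → a ≢ p × b ≢ p × (φ a , φ b) ∈ A
            R-ok ab∈ with ∈-redirectTargets⁻ ab∈
            ... | a , refl , ap∈ , a≢q =
              <⇒≢ (ordered ap∈) , (λ q≡p → 1+n≢n (sym (trans q≡p p≡1+q))) ,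
              subst (_∈ A) (sym (redirected ab∈)) st∈A

      avoids′ : ⊥
      avoids′ with bounded-search (λ p → φ p ≡ n) (λ p → φ p ≟ n) (size P)
      ... | inj₂ φ≢n              = avoids P∈F φ (restrict φ≢n)
      ... | inj₁ (p , p<k , φp≡n) = new-at p<k φp≡n (sinkHint P∈F p<k)
        where
        new-at : ∀ {p} → p < size P → φ p ≡ n → ∃ (SinkHint F P p) → ⊥
        new-at p<k φp≡n (wrongDirection , out) = wrongDirection-absurd p<k φp≡n out
        new-at {zero} p<k φp≡n (reduce _ r , _ , refuted) =
          refute good r refuted (embedding-renameSink p<k φp≡n λ ())
        new-at {suc q} p<k φp≡n (reduce m r , merged-refuted , refuted) with φ q ≟ t
        ... | no  φq≢t = refute good r refuted (embedding-renameSink p<k φp≡n (below-t p<k φp≡n refl φq≢t))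
        ... | yes φq≡t = merge-absurd m merged-refuted
          where
          merge-absurd : ∀ m → SinkMerge F P (suc q) m → ⊥
          merge-absurd atEnd           ()
          merge-absurd mergedAvailable found    = no-merged-available p<k φp≡n refl φq≡t found
          merge-absurd (merged r′)     refuted′ = refute good r′ refuted′ (embedding-mergeSink p<k φp≡n refl φq≡t)

    good′ : Good (suc n) E′ A′
    good′ = record
      { order      = record { rank = rk′ ; injective = rk′-injective (injective order) ; respects = respects′ }
      ; inRange    = inRange′
      ; available⊆ = A′⊆E′
      ; unique     = All.tabulate sn≢ ∷ All.tabulate tn≢ ∷ unique-─ unique st∈A
      ; neighbours = atMostTwoNeighbours-stellIn neighbours unique st∈A (not-reversed st∈A) (<⇒≢ ∘ neighbour-old)
      ; avoids     = λ P∈F φ emb → avoids′ P∈F emb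
      }
      where
      respects′ : ∀ {e} → e ∈ E′ → rk′ (src e) < rk′ (tgt e)
      respects′ (here refl)         = <-new⁺ s<n (m<n⇒m<1+n s<t)
      respects′ (there (here refl)) = <-new⁺ t<n (n<1+n (rk t))
      respects′ (there (there e∈))  = <-old⁺ (proj₁ (inRange e∈)) (proj₂ (inRange e∈)) (respects order e∈)

      inRange′ : ∀ {e} → e ∈ E′ → src e < suc n × tgt e < suc n
      inRange′ (here refl)         = m<n⇒m<1+n s<n , n<1+n n
      inRange′ (there (here refl)) = m<n⇒m<1+n t<n , n<1+n n
      inRange′ (there (there e∈))  = Product.map m<n⇒m<1+n m<n⇒m<1+n (inRange e∈)

      new∉ : ∀ {u} → (u , n) ∉ (A ─ st∈A)
      new∉ un∈ = <-irrefl refl (proj₂ (inRange (available⊆ (∈-─⁻ st∈A un∈))))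

      sn≢ : ∀ {e} → e ∈ (t , n) ∷ (A ─ st∈A) → (s , n) ≢ e
      sn≢ (here refl) refl = <-irrefl refl s<t
      sn≢ (there e∈) refl  = new∉ e∈

      tn≢ : ∀ {e} → e ∈ (A ─ st∈A) → (t , n) ≢ e
      tn≢ e∈ refl = new∉ e∈

  module SourceStep {n E A} (good : Good n E A) {s t} (st∈A : (s , t) ∈ A) where

    open Good good

    E′ A′ : List Edge
    E′ = (n , s) ∷ (n , t) ∷ E
    A′ = (n , s) ∷ (n , t) ∷ (A ─ st∈A)

    private
      rk : ℕ → ℕ
      rk = rank order

      st∈E : (s , t) ∈ E
      st∈E = available⊆ st∈A

      s<n : s < n
      s<n = proj₁ (inRange st∈E)

      t<n : t < n
      t<n = proj₂ (inRange st∈E)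

      s<t : rk s < rk t
      s<t = respects order st∈E

    A′⊆E′ : ∀ {e} → e ∈ A′ → e ∈ E′
    A′⊆E′ (here refl)         = here refl
    A′⊆E′ (there (here refl)) = there (here refl)
    A′⊆E′ (there (there e∈))  = there (there (available⊆ (∈-─⁻ st∈A e∈)))

    to-s-or-t : ∀ {v} → (n , v) ∈ E′ → v ≡ s ⊎ v ≡ t
    to-s-or-t (here refl)         = inj₁ refl
    to-s-or-t (there (here refl)) = inj₂ refl
    to-s-or-t (there (there nv∈)) = ⊥-elim (<-irrefl refl (proj₁ (inRange nv∈)))

    no-edge-into-new : ∀ {u} → (u , n) ∉ E′
    no-edge-into-new (here refl)         = <-irrefl refl s<n
    no-edge-into-new (there (here refl)) = <-irrefl refl t<n
    no-edge-into-new (there (there un∈)) = <-irrefl refl (proj₂ (inRange un∈))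

    st∉A′ : (s , t) ∉ A′
    st∉A′ (here refl)         = <-irrefl refl s<n
    st∉A′ (there (here refl)) = <-irrefl refl s<n
    st∉A′ (there (there st∈)) = ∉-─ unique st∈A st∈

    open NewVertex good (rk s) A′⊆E′ (λ uv∈ u≢n _ → ∈-stellOut⁻ uv∈ u≢n)
                                    (λ uv∈ u≢n _ → ∈-─⁻ st∈A (∈-stellOut⁻ uv∈ u≢n))

    module _ {P} (P∈F : P ∈ F) {φ} (emb : Embedding (suc n) E′ A′ rk′ P φ) where

      open Embedding emb
      open Embedded P∈F emb

      module _ {p} (p<k : p < size P) (φp≡n : φ p ≡ n) where

        open AtNew p<k φp≡n

        no-edge-into-p : ∀ {a} → (a , p) ∉ allEdges P
        no-edge-into-p {a} ap∈ = no-edge-into-new (subst (λ x → (φ a , x) ∈ E′) φp≡n (image ap∈))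

        wrongDirection-absurd : ¬ Any (λ e → tgt e ≡ p) (allEdges P)
        wrongDirection-absurd into with find into
        ... | _ , ap∈ , refl = no-edge-into-p ap∈

        target-of : ∀ {b} → (p , b) ∈ allEdges P → φ b ≡ s ⊎ φ b ≡ t
        target-of {b} pb∈ = to-s-or-t (subst (λ x → (x , φ b) ∈ E′) φp≡n (image pb∈))

        embedding-renameSource : (∀ {b} → p < b → b < size P → rk s < rk (φ b)) →
                                 Embedding n E A rk (renameSource P p) (φ [ p ≔ s ])
        embedding-renameSource above = embedding-rename _ (subst (_< n) (sym ψp≡s) s<n) ψ≡φ
          ψ-increasing touching extra-touching
          where
          ψ : ℕ → ℕ
          ψ = φ [ p ≔ s ]

          ψp≡s : ψ p ≡ s
          ψp≡s = update-≡ {φ} {p}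

          ψ≡φ : ∀ {j} → j ≢ p → ψ j ≡ φ j
          ψ≡φ = update-≢ {φ} {p}

          ψ-increasing : ∀ {j} → suc j < size P → rk (ψ j) < rk (ψ (suc j))
          ψ-increasing {j} 1+j<k with j ≟ p
          ... | yes refl =
            subst₂ (λ u v → rk u < rk v) (sym ψp≡s) (sym (ψ≡φ 1+n≢n))
              (above (n<1+n p) 1+j<k)
          ... | no j≢p with suc j ≟ p
          ...   | yes refl =
            subst₂ (λ u v → rk u < rk v) (sym (ψ≡φ j≢p)) (sym ψp≡s)
              (<-new⁻ (old′ (<-trans (n<1+n j) 1+j<k) j≢p) (subst (λ x → rk′ (φ j) < rk′ x) φp≡n (increasing 1+j<k)))
          ...   | no 1+j≢p =
            subst₂ (λ u v → rk u < rk v) (sym (ψ≡φ j≢p)) (sym (ψ≡φ 1+j≢p))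
              (<-old⁻ (old′ (<-trans (n<1+n j) 1+j<k) j≢p) (old′ 1+j<k 1+j≢p) (increasing 1+j<k))

          touching : ∀ {a b} → (a , b) ∈ allEdges P → a ≡ p ⊎ b ≡ p → (ψ a , ψ b) ∈ A
          touching {b = b} ab∈ (inj₁ refl) with target-of ab∈
          ... | inj₂ φb≡t = subst₂ (λ u v → (u , v) ∈ A) (sym ψp≡s)
                                   (sym (trans (ψ≡φ (>⇒≢ (ordered ab∈))) φb≡t)) st∈A
          ... | inj₁ φb≡s = ⊥-elim (<-irrefl (cong rk (sym φb≡s)) (above (ordered ab∈) (proj₂ (endpoints ab∈))))
          touching ab∈ (inj₂ refl) = ⊥-elim (no-edge-into-p ab∈)

          extra-touching : ∀ {e} → e ∈ filter (λ e → src e ≟ p) (allEdges P) → e ∈ allEdges P × (src e ≡ p ⊎ tgt e ≡ p)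
          extra-touching e∈ = Product.map₂ inj₁ (∈-filter⁻ (λ e → src e ≟ p) {xs = allEdges P} e∈)

        module _ (1+p<k : suc p < size P) where

          first-after-new : φ (suc p) ≢ s → rk s < rk (φ (suc p))
          first-after-new φ1+p≢s =
            ≤∧≢⇒< (>-new⁻ φ1+p<n (subst (λ x → rk′ x < rk′ (φ (suc p))) φp≡n (increasing 1+p<k)))
                  (φ1+p≢s ∘ sym ∘ injective order _ _ s<n φ1+p<n)
            where
            φ1+p<n : φ (suc p) < n
            φ1+p<n = old′ 1+p<k 1+n≢n

          above-s : φ (suc p) ≢ s → ∀ {b} → p < b → b < size P → rk s < rk (φ b)
          above-s φ1+p≢s {b} p<b b<k with m≤n⇒m<n∨m≡n p<b
          ... | inj₁ 1+p<b = <-trans (first-after-new φ1+p≢s)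
                               (<-old⁻ (old′ 1+p<k 1+n≢n) (old′ b<k (>⇒≢ p<b)) (increasing-< 1+p<b b<k))
          ... | inj₂ refl = first-after-new φ1+p≢s

          module _ (φ1+p≡s : φ (suc p) ≡ s) where

            redirected-to-t : ∀ {b} → (p , b) ∈ allEdges P → b ≢ suc p → φ b ≡ t
            redirected-to-t pb∈ b≢1+p with target-of pb∈
            ... | inj₂ φb≡t = φb≡t
            ... | inj₁ φb≡s = ⊥-elim (distinct (proj₂ (endpoints pb∈)) 1+p<k b≢1+p (trans φb≡s (sym φ1+p≡s)))

            redirected : ∀ {e} → e ∈ redirectSources p (suc p) (allEdges P) → (φ (src e) , φ (tgt e)) ≡ (s , t)
            redirected e∈ with ∈-redirectSources⁻ {p} {suc p} {allEdges P} e∈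
            ... | b , refl , pb∈ , b≢1+p = cong₂ _,_ φ1+p≡s (redirected-to-t pb∈ b≢1+p)

            no-merged-available : ¬ Any (_∈ available P) (redirectSources p (suc p) (allEdges P))
            no-merged-available found with find found
            ... | e , e∈R , e∈available = st∉A′ (subst (_∈ A′) (redirected e∈R) (available⁺ e∈available))

            embedding-mergeSource : Embedding n E A rk (mergeSource P p) (φ ∘ punchIn p)
            embedding-mergeSource = embedding-merge _ R-ok
              where
              R-ok : ∀ {a b} → (a , b) ∈ redirectSources p (suc p) (allEdges P) → a ≢ p × b ≢ p × (φ a , φ b) ∈ A
              R-ok ab∈ with ∈-redirectSources⁻ {p} {suc p} {allEdges P} ab∈
              ... | b , refl , pb∈ , _ =
                1+n≢n , >⇒≢ (ordered pb∈) ,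
                subst (_∈ A) (sym (redirected ab∈)) st∈A

      avoids′ : ⊥
      avoids′ with bounded-search (λ p → φ p ≡ n) (λ p → φ p ≟ n) (size P)
      ... | inj₂ φ≢n              = avoids P∈F φ (restrict φ≢n)
      ... | inj₁ (p , p<k , φp≡n) = new-at (sourceHint P∈F p<k)
        where
        new-at : ∃ (SourceHint F P p) → ⊥
        new-at (wrongDirection , into) = wrongDirection-absurd p<k φp≡n into
        new-at (reduce m r , merged-refuted , refuted) with suc p <? size P
        ... | no 1+p≮k = refute good r refuted (embedding-renameSource p<k φp≡n
                           λ p<b b<k → ⊥-elim (1+p≮k (≤-<-trans p<b b<k)))
        ... | yes 1+p<k with φ (suc p) ≟ s
        ...   | no  φ1+p≢s = refute good r refuted (embedding-renameSource p<k φp≡n (above-s p<k φp≡n 1+p<k φ1+p≢s))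
        ...   | yes φ1+p≡s = merge-absurd m merged-refuted
          where
          merge-absurd : ∀ m → SourceMerge F P p m → ⊥
          merge-absurd atEnd           1+p≡k    = <-irrefl 1+p≡k 1+p<k
          merge-absurd mergedAvailable found    = no-merged-available p<k φp≡n 1+p<k φ1+p≡s found
          merge-absurd (merged r′)     refuted′ = refute good r′ refuted′ (embedding-mergeSource p<k φp≡n 1+p<k φ1+p≡s)

    good′ : Good (suc n) E′ A′
    good′ = record
      { order      = record { rank = rk′ ; injective = rk′-injective (injective order) ; respects = respects′ }
      ; inRange    = inRange′
      ; available⊆ = A′⊆E′
      ; unique     = All.tabulate ns≢ ∷ All.tabulate nt≢ ∷ unique-─ unique st∈A
      ; neighbours = atMostTwoNeighbours-stellOut neighbours unique st∈A (not-reversed st∈A) (<⇒≢ ∘ neighbour-old)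
      ; avoids     = λ P∈F φ emb → avoids′ P∈F emb
      }
      where
      respects′ : ∀ {e} → e ∈ E′ → rk′ (src e) < rk′ (tgt e)
      respects′ (here refl)         = >-new⁺ s<n ≤-refl
      respects′ (there (here refl)) = >-new⁺ t<n (<⇒≤ s<t)
      respects′ (there (there e∈))  = <-old⁺ (proj₁ (inRange e∈)) (proj₂ (inRange e∈)) (respects order e∈)

      inRange′ : ∀ {e} → e ∈ E′ → src e < suc n × tgt e < suc n
      inRange′ (here refl)         = n<1+n n , m<n⇒m<1+n s<n
      inRange′ (there (here refl)) = n<1+n n , m<n⇒m<1+n t<n
      inRange′ (there (there e∈))  = Product.map m<n⇒m<1+n m<n⇒m<1+n (inRange e∈)

      new∉ : ∀ {v} → (n , v) ∉ (A ─ st∈A)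
      new∉ nv∈ = <-irrefl refl (proj₁ (inRange (available⊆ (∈-─⁻ st∈A nv∈))))

      ns≢ : ∀ {e} → e ∈ (n , t) ∷ (A ─ st∈A) → (n , s) ≢ e
      ns≢ (here refl) refl = <-irrefl refl s<t
      ns≢ (there e∈) refl  = new∉ e∈

      nt≢ : ∀ {e} → e ∈ (A ─ st∈A) → (n , t) ≢ e
      nt≢ e∈ refl = new∉ e∈

  good : ∀ {n E A} → MonotoneOuterplanarDAG n E A → Good n E A
  good start                        = good-start
  good (stellIn  d (_ , _ , st∈A)) = SinkStep.good′ (good d) st∈A
  good (stellOut d (_ , _ , st∈A)) = SourceStep.good′ (good d) st∈A

  twist-free : ∀ r → Refutes F twistPattern r →
               ∀ {n E A} → MonotoneOuterplanarDAG n E A → Σ (VertexOrder n E) (λ σ → ¬ Twist σ 5)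
  twist-free r refuted d = order , λ tw → refute (good d) r refuted (twist-embedding tw inRange)
    where open Good (good d)

-- The family

-- Unlike `≡-dec`, this needs no proof terms to compute `does`, which is all the
-- evaluation of the certificate below has to normalise.
_≟ₑ_ : DecidableEquality Edge
(a , b) ≟ₑ (c , d) =
  map′ (λ (a≡c , b≡d) → cong₂ _,_ a≡c b≡d) (λ eq → cong proj₁ eq , cong proj₂ eq) (a ≟ c ×-dec b ≟ d)

open import Data.List.Membership.DecPropositional _≟ₑ_ using (_∈?_)

_⊑?_ : ∀ R Q → Dec (R ⊑ Q)
R ⊑? Q = size R ≟ size Q ×-dec all? (_∈? edges Q) (edges R) ×-dec all? (_∈? available Q) (available R)

neighbour? : ∀ L v u → Dec (Neighbour L v u)
neighbour? L v u = (v , u) ∈? L ⊎-dec (u , v) ∈? L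

refutes? : ∀ F Q r → Dec (Refutes F Q r)
refutes? F Q (contains j)         = Maybe.dec (_⊑? Q) (head (drop j F))
refutes? F Q (overloaded v a b c) =
  all? (λ u → u <? size Q ×-dec neighbour? (available Q) v u) (a ∷ b ∷ c ∷ [])
  ×-dec ¬? (a ≟ b) ×-dec ¬? (a ≟ c) ×-dec ¬? (b ≟ c)

sinkHint? : ∀ F P p h → Dec (SinkHint F P p h)
sinkHint? F P p wrongDirection = any? (λ e → src e ≟ p) (allEdges P)
sinkHint? F P p (reduce m r)   = merge? m ×-dec refutes? F (renameSink P p) r
  where
  merge? : ∀ m → Dec (SinkMerge F P p m)
  merge? atEnd           = p ≟ 0
  merge? mergedAvailable = any? (_∈? available P) (redirectTargets p (pred p) (allEdges P))
  merge? (merged r)      = refutes? F (mergeSink P p) r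

sourceHint? : ∀ F P p h → Dec (SourceHint F P p h)
sourceHint? F P p wrongDirection = any? (λ e → tgt e ≟ p) (allEdges P)
sourceHint? F P p (reduce m r)   = merge? m ×-dec refutes? F (renameSource P p) r
  where
  merge? : ∀ m → Dec (SourceMerge F P p m)
  merge? atEnd           = suc p ≟ size P
  merge? mergedAvailable = any? (_∈? available P) (redirectSources p (suc p) (allEdges P))
  merge? (merged r)      = refutes? F (mergeSource P p) r

hintsFrom? : ∀ F P p hs → Dec (HintsFrom F P p hs)
hintsFrom? F P p []              = p ≟ size P
hintsFrom? F P p ((h , h′) ∷ hs) = (sinkHint? F P p h ×-dec sourceHint? F P p h′) ×-dec hintsFrom? F P (suc p) hs

validEntry? : ∀ F e → Dec (ValidEntry F e)
validEntry? F (P , hs) =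
  (all? (λ e → src e <? tgt e ×-dec tgt e <? size P) (allEdges P) ×-dec 2 <? size P) ×-dec hintsFrom? F P 0 hs

entries : List Entry
entries =
  (mkPattern 5 ((0 , 1) ∷ (0 , 2) ∷ (0 , 3) ∷ (1 , 3) ∷ (1 , 4) ∷ []) ((0 , 1) ∷ (0 , 2) ∷ (1 , 3) ∷ []) , ((wrongDirection , (reduce mergedAvailable (contains 0))) ∷ (wrongDirection , wrongDirection) ∷ ((reduce mergedAvailable (contains 0)) , wrongDirection) ∷ ((reduce mergedAvailable (contains 0)) , wrongDirection) ∷ ((reduce mergedAvailable (contains 0)) , wrongDirection) ∷ []))
  ∷ (mkPattern 5 ((0 , 2) ∷ (0 , 3) ∷ (1 , 3) ∷ (1 , 4) ∷ (2 , 4) ∷ []) ((0 , 2) ∷ (1 , 3) ∷ (2 , 4) ∷ []) , ((wrongDirection , (reduce mergedAvailable (contains 1))) ∷ (wrongDirection , (reduce mergedAvailable (contains 1))) ∷ (wrongDirection , wrongDirection) ∷ ((reduce mergedAvailable (contains 1)) , wrongDirection) ∷ ((reduce mergedAvailable (contains 1)) , wrongDirection) ∷ []))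
  ∷ (mkPattern 5 ((0 , 2) ∷ (0 , 3) ∷ (1 , 3) ∷ (2 , 3) ∷ (2 , 4) ∷ []) ((0 , 2) ∷ (1 , 3) ∷ (2 , 3) ∷ []) , ((wrongDirection , (reduce mergedAvailable (contains 2))) ∷ (wrongDirection , (reduce mergedAvailable (contains 2))) ∷ (wrongDirection , wrongDirection) ∷ ((reduce mergedAvailable (contains 2)) , wrongDirection) ∷ ((reduce mergedAvailable (contains 2)) , wrongDirection) ∷ []))
  ∷ (mkPattern 5 ((0 , 2) ∷ (1 , 2) ∷ (1 , 3) ∷ (1 , 4) ∷ (2 , 4) ∷ []) ((1 , 2) ∷ (1 , 3) ∷ (2 , 4) ∷ []) , ((wrongDirection , (reduce mergedAvailable (contains 3))) ∷ (wrongDirection , (reduce mergedAvailable (contains 3))) ∷ (wrongDirection , wrongDirection) ∷ ((reduce mergedAvailable (contains 3)) , wrongDirection) ∷ ((reduce mergedAvailable (contains 3)) , wrongDirection) ∷ []))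
  ∷ (mkPattern 5 ((0 , 3) ∷ (1 , 3) ∷ (1 , 4) ∷ (2 , 4) ∷ (3 , 4) ∷ []) ((1 , 3) ∷ (2 , 4) ∷ (3 , 4) ∷ []) , ((wrongDirection , (reduce mergedAvailable (contains 4))) ∷ (wrongDirection , (reduce mergedAvailable (contains 4))) ∷ (wrongDirection , (reduce mergedAvailable (contains 4))) ∷ (wrongDirection , wrongDirection) ∷ ((reduce mergedAvailable (contains 4)) , wrongDirection) ∷ []))
  ∷ (mkPattern 5 ((0 , 2) ∷ (0 , 3) ∷ (0 , 4) ∷ (1 , 4) ∷ (2 , 4) ∷ []) ((0 , 2) ∷ (0 , 3) ∷ (1 , 4) ∷ (2 , 4) ∷ []) , ((wrongDirection , (reduce mergedAvailable (contains 5))) ∷ (wrongDirection , (reduce mergedAvailable (contains 5))) ∷ (wrongDirection , wrongDirection) ∷ ((reduce mergedAvailable (contains 5)) , wrongDirection) ∷ ((reduce mergedAvailable (contains 5)) , wrongDirection) ∷ []))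
  ∷ (mkPattern 6 ((0 , 2) ∷ (0 , 3) ∷ (1 , 3) ∷ (1 , 4) ∷ (2 , 5) ∷ []) ((0 , 2) ∷ (1 , 3) ∷ []) , ((wrongDirection , (reduce mergedAvailable (contains 6))) ∷ (wrongDirection , (reduce (merged (overloaded 1 0 2 3)) (contains 6))) ∷ (wrongDirection , wrongDirection) ∷ ((reduce mergedAvailable (contains 6)) , wrongDirection) ∷ ((reduce mergedAvailable (contains 6)) , wrongDirection) ∷ ((reduce (merged (contains 1)) (contains 6)) , wrongDirection) ∷ []))
  ∷ (mkPattern 6 ((0 , 2) ∷ (0 , 3) ∷ (1 , 4) ∷ (2 , 4) ∷ (2 , 5) ∷ []) ((0 , 2) ∷ (2 , 4) ∷ []) , ((wrongDirection , (reduce (merged (contains 0)) (contains 7))) ∷ (wrongDirection , (reduce mergedAvailable (contains 7))) ∷ (wrongDirection , wrongDirection) ∷ ((reduce mergedAvailable (contains 7)) , wrongDirection) ∷ ((reduce (merged (contains 2)) (contains 7)) , wrongDirection) ∷ ((reduce mergedAvailable (contains 7)) , wrongDirection) ∷ []))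
  ∷ (mkPattern 6 ((0 , 3) ∷ (1 , 3) ∷ (1 , 4) ∷ (2 , 4) ∷ (2 , 5) ∷ []) ((1 , 3) ∷ (2 , 4) ∷ []) , ((wrongDirection , (reduce mergedAvailable (contains 8))) ∷ (wrongDirection , (reduce mergedAvailable (contains 8))) ∷ (wrongDirection , (reduce (merged (overloaded 2 1 3 4)) (contains 8))) ∷ ((reduce (merged (overloaded 2 0 1 3)) (contains 8)) , wrongDirection) ∷ ((reduce mergedAvailable (contains 8)) , wrongDirection) ∷ ((reduce mergedAvailable (contains 8)) , wrongDirection) ∷ []))
  ∷ (mkPattern 6 ((0 , 3) ∷ (1 , 3) ∷ (1 , 4) ∷ (2 , 5) ∷ (3 , 5) ∷ []) ((1 , 3) ∷ (3 , 5) ∷ []) , ((wrongDirection , (reduce mergedAvailable (contains 9))) ∷ (wrongDirection , (reduce (merged (contains 3)) (contains 9))) ∷ (wrongDirection , (reduce mergedAvailable (contains 9))) ∷ (wrongDirection , wrongDirection) ∷ ((reduce mergedAvailable (contains 9)) , wrongDirection) ∷ ((reduce (merged (contains 4)) (contains 9)) , wrongDirection) ∷ []))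
  ∷ (mkPattern 6 ((0 , 3) ∷ (1 , 4) ∷ (2 , 4) ∷ (2 , 5) ∷ (3 , 5) ∷ []) ((2 , 4) ∷ (3 , 5) ∷ []) , ((wrongDirection , (reduce (merged (contains 1)) (contains 10))) ∷ (wrongDirection , (reduce mergedAvailable (contains 10))) ∷ (wrongDirection , (reduce mergedAvailable (contains 10))) ∷ (wrongDirection , wrongDirection) ∷ ((reduce (merged (overloaded 3 1 2 4)) (contains 10)) , wrongDirection) ∷ ((reduce mergedAvailable (contains 10)) , wrongDirection) ∷ []))
  ∷ (mkPattern 6 ((0 , 1) ∷ (0 , 2) ∷ (0 , 3) ∷ (1 , 4) ∷ (1 , 5) ∷ []) ((0 , 1) ∷ (0 , 2) ∷ (1 , 4) ∷ []) , ((wrongDirection , (reduce (merged (overloaded 0 1 2 3)) (contains 11))) ∷ (wrongDirection , wrongDirection) ∷ ((reduce mergedAvailable (contains 11)) , wrongDirection) ∷ ((reduce mergedAvailable (contains 11)) , wrongDirection) ∷ ((reduce (merged (contains 0)) (contains 11)) , wrongDirection) ∷ ((reduce mergedAvailable (contains 11)) , wrongDirection) ∷ []))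
  ∷ (mkPattern 6 ((0 , 2) ∷ (0 , 3) ∷ (0 , 4) ∷ (1 , 4) ∷ (1 , 5) ∷ []) ((0 , 2) ∷ (0 , 3) ∷ (1 , 4) ∷ []) , ((wrongDirection , (reduce mergedAvailable (contains 12))) ∷ (wrongDirection , (reduce (merged (contains 0)) (contains 12))) ∷ ((reduce (merged (contains 0)) (contains 12)) , wrongDirection) ∷ ((reduce mergedAvailable (contains 12)) , wrongDirection) ∷ ((reduce mergedAvailable (contains 12)) , wrongDirection) ∷ ((reduce mergedAvailable (contains 12)) , wrongDirection) ∷ []))
  ∷ (mkPattern 6 ((0 , 2) ∷ (0 , 3) ∷ (0 , 4) ∷ (1 , 4) ∷ (2 , 5) ∷ []) ((0 , 2) ∷ (0 , 3) ∷ (1 , 4) ∷ []) , ((wrongDirection , (reduce mergedAvailable (contains 13))) ∷ (wrongDirection , (reduce (merged (contains 0)) (contains 13))) ∷ (wrongDirection , wrongDirection) ∷ ((reduce mergedAvailable (contains 13)) , wrongDirection) ∷ ((reduce mergedAvailable (contains 13)) , wrongDirection) ∷ ((reduce (merged (contains 5)) (contains 13)) , wrongDirection) ∷ []))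
  ∷ (mkPattern 6 ((0 , 2) ∷ (0 , 3) ∷ (0 , 4) ∷ (1 , 5) ∷ (2 , 5) ∷ []) ((0 , 2) ∷ (0 , 3) ∷ (2 , 5) ∷ []) , ((wrongDirection , (reduce (merged (overloaded 0 1 2 3)) (contains 14))) ∷ (wrongDirection , (reduce mergedAvailable (contains 14))) ∷ (wrongDirection , wrongDirection) ∷ ((reduce mergedAvailable (contains 14)) , wrongDirection) ∷ ((reduce mergedAvailable (contains 14)) , wrongDirection) ∷ ((reduce (merged (contains 5)) (contains 14)) , wrongDirection) ∷ []))
  ∷ (mkPattern 6 ((0 , 2) ∷ (0 , 3) ∷ (1 , 3) ∷ (1 , 4) ∷ (1 , 5) ∷ []) ((0 , 2) ∷ (1 , 3) ∷ (1 , 4) ∷ []) , ((wrongDirection , (reduce mergedAvailable (contains 15))) ∷ (wrongDirection , (reduce (merged (overloaded 1 0 2 3)) (contains 15))) ∷ ((reduce (merged (overloaded 1 0 2 3)) (contains 15)) , wrongDirection) ∷ ((reduce mergedAvailable (contains 15)) , wrongDirection) ∷ ((reduce mergedAvailable (contains 15)) , wrongDirection) ∷ ((reduce mergedAvailable (contains 15)) , wrongDirection) ∷ []))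
  ∷ (mkPattern 6 ((0 , 2) ∷ (0 , 3) ∷ (1 , 3) ∷ (2 , 4) ∷ (2 , 5) ∷ []) ((0 , 2) ∷ (1 , 3) ∷ (2 , 4) ∷ []) , ((wrongDirection , (reduce mergedAvailable (contains 16))) ∷ (wrongDirection , (reduce (merged (overloaded 1 0 2 3)) (contains 16))) ∷ (wrongDirection , wrongDirection) ∷ ((reduce mergedAvailable (contains 16)) , wrongDirection) ∷ ((reduce (merged (contains 2)) (contains 16)) , wrongDirection) ∷ ((reduce mergedAvailable (contains 16)) , wrongDirection) ∷ []))
  ∷ (mkPattern 6 ((0 , 2) ∷ (0 , 3) ∷ (1 , 4) ∷ (1 , 5) ∷ (2 , 5) ∷ []) ((0 , 2) ∷ (1 , 4) ∷ (2 , 5) ∷ []) , ((wrongDirection , (reduce (merged (overloaded 0 1 2 3)) (contains 17))) ∷ (wrongDirection , (reduce mergedAvailable (contains 17))) ∷ (wrongDirection , wrongDirection) ∷ ((reduce mergedAvailable (contains 17)) , wrongDirection) ∷ ((reduce (merged (contains 1)) (contains 17)) , wrongDirection) ∷ ((reduce mergedAvailable (contains 17)) , wrongDirection) ∷ []))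
  ∷ (mkPattern 6 ((0 , 2) ∷ (1 , 2) ∷ (1 , 3) ∷ (1 , 4) ∷ (2 , 5) ∷ []) ((0 , 2) ∷ (1 , 2) ∷ (1 , 3) ∷ []) , ((wrongDirection , (reduce mergedAvailable (contains 18))) ∷ (wrongDirection , (reduce (merged (overloaded 1 0 2 3)) (contains 18))) ∷ (wrongDirection , wrongDirection) ∷ ((reduce mergedAvailable (contains 18)) , wrongDirection) ∷ ((reduce mergedAvailable (contains 18)) , wrongDirection) ∷ ((reduce (merged (contains 3)) (contains 18)) , wrongDirection) ∷ []))
  ∷ (mkPattern 6 ((0 , 2) ∷ (1 , 2) ∷ (1 , 3) ∷ (1 , 4) ∷ (2 , 5) ∷ []) ((1 , 2) ∷ (1 , 3) ∷ (2 , 5) ∷ []) , ((wrongDirection , (reduce mergedAvailable (contains 18))) ∷ (wrongDirection , (reduce (merged (overloaded 1 2 3 4)) (contains 19))) ∷ (wrongDirection , wrongDirection) ∷ ((reduce mergedAvailable (contains 19)) , wrongDirection) ∷ ((reduce mergedAvailable (contains 19)) , wrongDirection) ∷ ((reduce (merged (contains 3)) (contains 19)) , wrongDirection) ∷ []))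
  ∷ (mkPattern 6 ((0 , 2) ∷ (1 , 3) ∷ (1 , 4) ∷ (1 , 5) ∷ (2 , 5) ∷ []) ((1 , 3) ∷ (1 , 4) ∷ (2 , 5) ∷ []) , ((wrongDirection , (reduce (merged (overloaded 0 1 2 3)) (contains 20))) ∷ (wrongDirection , (reduce mergedAvailable (contains 20))) ∷ (wrongDirection , wrongDirection) ∷ ((reduce (merged (contains 3)) (contains 20)) , wrongDirection) ∷ ((reduce mergedAvailable (contains 20)) , wrongDirection) ∷ ((reduce mergedAvailable (contains 20)) , wrongDirection) ∷ []))
  ∷ (mkPattern 6 ((0 , 2) ∷ (1 , 3) ∷ (1 , 4) ∷ (2 , 4) ∷ (2 , 5) ∷ []) ((0 , 2) ∷ (1 , 3) ∷ (2 , 4) ∷ []) , ((wrongDirection , (reduce (merged (contains 0)) (contains 21))) ∷ (wrongDirection , (reduce mergedAvailable (contains 21))) ∷ (wrongDirection , wrongDirection) ∷ ((reduce (merged (overloaded 2 0 1 3)) (contains 21)) , wrongDirection) ∷ ((reduce mergedAvailable (contains 21)) , wrongDirection) ∷ ((reduce mergedAvailable (contains 21)) , wrongDirection) ∷ []))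
  ∷ (mkPattern 6 ((0 , 2) ∷ (1 , 3) ∷ (1 , 4) ∷ (2 , 4) ∷ (2 , 5) ∷ []) ((1 , 3) ∷ (2 , 4) ∷ (2 , 5) ∷ []) , ((wrongDirection , (reduce (merged (contains 0)) (contains 21))) ∷ (wrongDirection , (reduce mergedAvailable (contains 22))) ∷ (wrongDirection , wrongDirection) ∷ ((reduce (merged (overloaded 2 1 3 4)) (contains 22)) , wrongDirection) ∷ ((reduce mergedAvailable (contains 22)) , wrongDirection) ∷ ((reduce mergedAvailable (contains 22)) , wrongDirection) ∷ []))
  ∷ (mkPattern 6 ((0 , 3) ∷ (0 , 4) ∷ (1 , 4) ∷ (1 , 5) ∷ (2 , 5) ∷ []) ((0 , 3) ∷ (1 , 4) ∷ (2 , 5) ∷ []) , ((wrongDirection , (reduce mergedAvailable (contains 23))) ∷ (wrongDirection , (reduce mergedAvailable (contains 23))) ∷ (wrongDirection , (reduce (merged (contains 1)) (contains 23))) ∷ ((reduce (merged (contains 1)) (contains 23)) , wrongDirection) ∷ ((reduce mergedAvailable (contains 23)) , wrongDirection) ∷ ((reduce mergedAvailable (contains 23)) , wrongDirection) ∷ []))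
  ∷ (mkPattern 6 ((0 , 3) ∷ (0 , 4) ∷ (1 , 4) ∷ (2 , 4) ∷ (2 , 5) ∷ []) ((0 , 3) ∷ (1 , 4) ∷ (2 , 4) ∷ []) , ((wrongDirection , (reduce mergedAvailable (contains 24))) ∷ (wrongDirection , (reduce mergedAvailable (contains 24))) ∷ (wrongDirection , (reduce (merged (contains 2)) (contains 24))) ∷ ((reduce (merged (contains 2)) (contains 24)) , wrongDirection) ∷ ((reduce mergedAvailable (contains 24)) , wrongDirection) ∷ ((reduce mergedAvailable (contains 24)) , wrongDirection) ∷ []))
  ∷ (mkPattern 6 ((0 , 3) ∷ (0 , 4) ∷ (1 , 4) ∷ (2 , 4) ∷ (3 , 5) ∷ []) ((0 , 3) ∷ (1 , 4) ∷ (2 , 4) ∷ []) , ((wrongDirection , (reduce mergedAvailable (contains 25))) ∷ (wrongDirection , (reduce mergedAvailable (contains 25))) ∷ (wrongDirection , (reduce (merged (contains 2)) (contains 25))) ∷ (wrongDirection , wrongDirection) ∷ ((reduce mergedAvailable (contains 25)) , wrongDirection) ∷ ((reduce (merged (overloaded 4 1 2 3)) (contains 25)) , wrongDirection) ∷ []))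
  ∷ (mkPattern 6 ((0 , 3) ∷ (0 , 4) ∷ (1 , 4) ∷ (2 , 5) ∷ (3 , 5) ∷ []) ((0 , 3) ∷ (1 , 4) ∷ (3 , 5) ∷ []) , ((wrongDirection , (reduce mergedAvailable (contains 26))) ∷ (wrongDirection , (reduce (merged (contains 1)) (contains 26))) ∷ (wrongDirection , (reduce mergedAvailable (contains 26))) ∷ (wrongDirection , wrongDirection) ∷ ((reduce mergedAvailable (contains 26)) , wrongDirection) ∷ ((reduce (merged (overloaded 4 1 2 3)) (contains 26)) , wrongDirection) ∷ []))
  ∷ (mkPattern 6 ((0 , 3) ∷ (0 , 4) ∷ (1 , 5) ∷ (2 , 5) ∷ (3 , 5) ∷ []) ((0 , 3) ∷ (2 , 5) ∷ (3 , 5) ∷ []) , ((wrongDirection , (reduce (merged (contains 5)) (contains 27))) ∷ (wrongDirection , (reduce mergedAvailable (contains 27))) ∷ (wrongDirection , (reduce mergedAvailable (contains 27))) ∷ (wrongDirection , wrongDirection) ∷ ((reduce mergedAvailable (contains 27)) , wrongDirection) ∷ ((reduce (merged (overloaded 4 1 2 3)) (contains 27)) , wrongDirection) ∷ []))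
  ∷ (mkPattern 6 ((0 , 3) ∷ (1 , 3) ∷ (1 , 4) ∷ (1 , 5) ∷ (2 , 5) ∷ []) ((1 , 3) ∷ (1 , 4) ∷ (2 , 5) ∷ []) , ((wrongDirection , (reduce mergedAvailable (contains 28))) ∷ (wrongDirection , (reduce mergedAvailable (contains 28))) ∷ (wrongDirection , (reduce (merged (contains 3)) (contains 28))) ∷ ((reduce (merged (contains 3)) (contains 28)) , wrongDirection) ∷ ((reduce mergedAvailable (contains 28)) , wrongDirection) ∷ ((reduce mergedAvailable (contains 28)) , wrongDirection) ∷ []))
  ∷ (mkPattern 6 ((0 , 3) ∷ (1 , 3) ∷ (1 , 4) ∷ (2 , 4) ∷ (3 , 5) ∷ []) ((0 , 3) ∷ (1 , 3) ∷ (2 , 4) ∷ []) , ((wrongDirection , (reduce mergedAvailable (contains 29))) ∷ (wrongDirection , (reduce mergedAvailable (contains 29))) ∷ (wrongDirection , (reduce (merged (overloaded 2 0 1 3)) (contains 29))) ∷ (wrongDirection , wrongDirection) ∷ ((reduce mergedAvailable (contains 29)) , wrongDirection) ∷ ((reduce (merged (contains 4)) (contains 29)) , wrongDirection) ∷ []))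
  ∷ (mkPattern 6 ((0 , 3) ∷ (1 , 3) ∷ (1 , 4) ∷ (2 , 4) ∷ (3 , 5) ∷ []) ((1 , 3) ∷ (2 , 4) ∷ (3 , 5) ∷ []) , ((wrongDirection , (reduce mergedAvailable (contains 29))) ∷ (wrongDirection , (reduce mergedAvailable (contains 30))) ∷ (wrongDirection , (reduce (merged (overloaded 2 1 3 4)) (contains 30))) ∷ (wrongDirection , wrongDirection) ∷ ((reduce mergedAvailable (contains 30)) , wrongDirection) ∷ ((reduce (merged (contains 4)) (contains 30)) , wrongDirection) ∷ []))
  ∷ (mkPattern 6 ((0 , 3) ∷ (1 , 3) ∷ (2 , 3) ∷ (2 , 4) ∷ (2 , 5) ∷ []) ((1 , 3) ∷ (2 , 3) ∷ (2 , 4) ∷ []) , ((wrongDirection , (reduce mergedAvailable (contains 31))) ∷ (wrongDirection , (reduce mergedAvailable (contains 31))) ∷ (wrongDirection , (reduce (merged (overloaded 2 1 3 4)) (contains 31))) ∷ ((reduce (merged (overloaded 2 0 1 3)) (contains 31)) , wrongDirection) ∷ ((reduce mergedAvailable (contains 31)) , wrongDirection) ∷ ((reduce mergedAvailable (contains 31)) , wrongDirection) ∷ []))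
  ∷ (mkPattern 6 ((0 , 3) ∷ (1 , 3) ∷ (2 , 4) ∷ (2 , 5) ∷ (3 , 5) ∷ []) ((1 , 3) ∷ (2 , 4) ∷ (3 , 5) ∷ []) , ((wrongDirection , (reduce mergedAvailable (contains 32))) ∷ (wrongDirection , (reduce (merged (contains 3)) (contains 32))) ∷ (wrongDirection , (reduce mergedAvailable (contains 32))) ∷ (wrongDirection , wrongDirection) ∷ ((reduce (merged (overloaded 3 1 2 4)) (contains 32)) , wrongDirection) ∷ ((reduce mergedAvailable (contains 32)) , wrongDirection) ∷ []))
  ∷ (mkPattern 6 ((0 , 3) ∷ (1 , 4) ∷ (1 , 5) ∷ (2 , 5) ∷ (3 , 5) ∷ []) ((1 , 4) ∷ (2 , 5) ∷ (3 , 5) ∷ []) , ((wrongDirection , (reduce (merged (contains 5)) (contains 33))) ∷ (wrongDirection , (reduce mergedAvailable (contains 33))) ∷ (wrongDirection , (reduce mergedAvailable (contains 33))) ∷ (wrongDirection , wrongDirection) ∷ ((reduce (merged (contains 4)) (contains 33)) , wrongDirection) ∷ ((reduce mergedAvailable (contains 33)) , wrongDirection) ∷ []))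
  ∷ (mkPattern 6 ((0 , 3) ∷ (1 , 4) ∷ (2 , 4) ∷ (3 , 4) ∷ (3 , 5) ∷ []) ((0 , 3) ∷ (2 , 4) ∷ (3 , 4) ∷ []) , ((wrongDirection , (reduce (merged (contains 2)) (contains 34))) ∷ (wrongDirection , (reduce mergedAvailable (contains 34))) ∷ (wrongDirection , (reduce mergedAvailable (contains 34))) ∷ (wrongDirection , wrongDirection) ∷ ((reduce (merged (overloaded 3 0 1 2)) (contains 34)) , wrongDirection) ∷ ((reduce mergedAvailable (contains 34)) , wrongDirection) ∷ []))
  ∷ (mkPattern 6 ((0 , 3) ∷ (1 , 4) ∷ (2 , 4) ∷ (3 , 4) ∷ (3 , 5) ∷ []) ((2 , 4) ∷ (3 , 4) ∷ (3 , 5) ∷ []) , ((wrongDirection , (reduce (merged (contains 2)) (contains 34))) ∷ (wrongDirection , (reduce mergedAvailable (contains 35))) ∷ (wrongDirection , (reduce mergedAvailable (contains 35))) ∷ (wrongDirection , wrongDirection) ∷ ((reduce (merged (overloaded 3 1 2 4)) (contains 35)) , wrongDirection) ∷ ((reduce mergedAvailable (contains 35)) , wrongDirection) ∷ []))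
  ∷ (mkPattern 6 ((0 , 4) ∷ (1 , 4) ∷ (1 , 5) ∷ (2 , 5) ∷ (3 , 5) ∷ []) ((1 , 4) ∷ (2 , 5) ∷ (3 , 5) ∷ []) , ((wrongDirection , (reduce mergedAvailable (contains 36))) ∷ (wrongDirection , (reduce mergedAvailable (contains 36))) ∷ (wrongDirection , (reduce mergedAvailable (contains 36))) ∷ (wrongDirection , (reduce (merged (contains 4)) (contains 36))) ∷ ((reduce (merged (contains 4)) (contains 36)) , wrongDirection) ∷ ((reduce mergedAvailable (contains 36)) , wrongDirection) ∷ []))
  ∷ (mkPattern 6 ((0 , 4) ∷ (1 , 4) ∷ (2 , 4) ∷ (2 , 5) ∷ (3 , 5) ∷ []) ((1 , 4) ∷ (2 , 4) ∷ (3 , 5) ∷ []) , ((wrongDirection , (reduce mergedAvailable (contains 37))) ∷ (wrongDirection , (reduce mergedAvailable (contains 37))) ∷ (wrongDirection , (reduce mergedAvailable (contains 37))) ∷ (wrongDirection , (reduce (merged (overloaded 3 1 2 4)) (contains 37))) ∷ ((reduce (merged (overloaded 3 0 1 2)) (contains 37)) , wrongDirection) ∷ ((reduce mergedAvailable (contains 37)) , wrongDirection) ∷ []))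
  ∷ (mkPattern 6 ((0 , 4) ∷ (1 , 4) ∷ (2 , 5) ∷ (3 , 5) ∷ (4 , 5) ∷ []) ((1 , 4) ∷ (3 , 5) ∷ (4 , 5) ∷ []) , ((wrongDirection , (reduce mergedAvailable (contains 38))) ∷ (wrongDirection , (reduce (merged (contains 4)) (contains 38))) ∷ (wrongDirection , (reduce mergedAvailable (contains 38))) ∷ (wrongDirection , (reduce mergedAvailable (contains 38))) ∷ (wrongDirection , wrongDirection) ∷ ((reduce (merged (overloaded 4 1 2 3)) (contains 38)) , wrongDirection) ∷ []))
  ∷ (mkPattern 6 ((0 , 3) ∷ (0 , 4) ∷ (0 , 5) ∷ (1 , 5) ∷ (2 , 5) ∷ []) ((0 , 3) ∷ (0 , 4) ∷ (1 , 5) ∷ (2 , 5) ∷ []) , ((wrongDirection , (reduce mergedAvailable (contains 39))) ∷ (wrongDirection , (reduce mergedAvailable (contains 39))) ∷ (wrongDirection , (reduce (merged (contains 5)) (contains 39))) ∷ ((reduce (merged (contains 5)) (contains 39)) , wrongDirection) ∷ ((reduce mergedAvailable (contains 39)) , wrongDirection) ∷ ((reduce mergedAvailable (contains 39)) , wrongDirection) ∷ []))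
  ∷ (mkPattern 7 ((0 , 2) ∷ (0 , 3) ∷ (0 , 4) ∷ (1 , 5) ∷ (2 , 6) ∷ []) ((0 , 2) ∷ (0 , 3) ∷ []) , ((wrongDirection , (reduce (merged (overloaded 0 1 2 3)) (contains 40))) ∷ (wrongDirection , (reduce (merged (contains 11)) (contains 40))) ∷ (wrongDirection , wrongDirection) ∷ ((reduce mergedAvailable (contains 40)) , wrongDirection) ∷ ((reduce mergedAvailable (contains 40)) , wrongDirection) ∷ ((reduce (merged (contains 13)) (contains 40)) , wrongDirection) ∷ ((reduce (merged (contains 14)) (contains 40)) , wrongDirection) ∷ []))
  ∷ (mkPattern 7 ((0 , 2) ∷ (0 , 3) ∷ (1 , 4) ∷ (1 , 5) ∷ (2 , 6) ∷ []) ((0 , 2) ∷ (1 , 4) ∷ []) , ((wrongDirection , (reduce (merged (overloaded 0 1 2 3)) (contains 41))) ∷ (wrongDirection , (reduce (merged (overloaded 1 0 3 4)) (contains 41))) ∷ (wrongDirection , wrongDirection) ∷ ((reduce mergedAvailable (contains 41)) , wrongDirection) ∷ ((reduce (merged (contains 6)) (contains 41)) , wrongDirection) ∷ ((reduce mergedAvailable (contains 41)) , wrongDirection) ∷ ((reduce (merged (contains 17)) (contains 41)) , wrongDirection) ∷ []))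
  ∷ (mkPattern 7 ((0 , 2) ∷ (0 , 3) ∷ (1 , 4) ∷ (2 , 5) ∷ (2 , 6) ∷ []) ((0 , 2) ∷ (2 , 5) ∷ []) , ((wrongDirection , (reduce (merged (contains 11)) (contains 42))) ∷ (wrongDirection , (reduce (merged (overloaded 1 0 3 4)) (contains 42))) ∷ (wrongDirection , wrongDirection) ∷ ((reduce mergedAvailable (contains 42)) , wrongDirection) ∷ ((reduce (merged (contains 16)) (contains 42)) , wrongDirection) ∷ ((reduce (merged (contains 7)) (contains 42)) , wrongDirection) ∷ ((reduce mergedAvailable (contains 42)) , wrongDirection) ∷ []))
  ∷ (mkPattern 7 ((0 , 3) ∷ (0 , 4) ∷ (1 , 4) ∷ (1 , 5) ∷ (2 , 6) ∷ []) ((0 , 3) ∷ (1 , 4) ∷ []) , ((wrongDirection , (reduce mergedAvailable (contains 43))) ∷ (wrongDirection , (reduce (merged (contains 15)) (contains 43))) ∷ (wrongDirection , (reduce (merged (contains 6)) (contains 43))) ∷ ((reduce (merged (contains 6)) (contains 43)) , wrongDirection) ∷ ((reduce mergedAvailable (contains 43)) , wrongDirection) ∷ ((reduce mergedAvailable (contains 43)) , wrongDirection) ∷ ((reduce (merged (contains 23)) (contains 43)) , wrongDirection) ∷ []))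
  ∷ (mkPattern 7 ((0 , 3) ∷ (0 , 4) ∷ (1 , 4) ∷ (2 , 5) ∷ (3 , 6) ∷ []) ((0 , 3) ∷ (1 , 4) ∷ []) , ((wrongDirection , (reduce mergedAvailable (contains 44))) ∷ (wrongDirection , (reduce (merged (contains 6)) (contains 44))) ∷ (wrongDirection , (reduce (merged (contains 16)) (contains 44))) ∷ (wrongDirection , wrongDirection) ∷ ((reduce mergedAvailable (contains 44)) , wrongDirection) ∷ ((reduce (merged (contains 25)) (contains 44)) , wrongDirection) ∷ ((reduce (merged (contains 26)) (contains 44)) , wrongDirection) ∷ []))
  ∷ (mkPattern 7 ((0 , 3) ∷ (0 , 4) ∷ (1 , 5) ∷ (2 , 5) ∷ (2 , 6) ∷ []) ((0 , 3) ∷ (2 , 5) ∷ []) , ((wrongDirection , (reduce (merged (contains 12)) (contains 45))) ∷ (wrongDirection , (reduce mergedAvailable (contains 45))) ∷ (wrongDirection , (reduce (merged (contains 7)) (contains 45))) ∷ ((reduce (merged (contains 7)) (contains 45)) , wrongDirection) ∷ ((reduce mergedAvailable (contains 45)) , wrongDirection) ∷ ((reduce (merged (contains 24)) (contains 45)) , wrongDirection) ∷ ((reduce mergedAvailable (contains 45)) , wrongDirection) ∷ []))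
  ∷ (mkPattern 7 ((0 , 3) ∷ (0 , 4) ∷ (1 , 5) ∷ (2 , 5) ∷ (3 , 6) ∷ []) ((0 , 3) ∷ (2 , 5) ∷ []) , ((wrongDirection , (reduce (merged (contains 13)) (contains 46))) ∷ (wrongDirection , (reduce mergedAvailable (contains 46))) ∷ (wrongDirection , (reduce (merged (contains 7)) (contains 46))) ∷ (wrongDirection , wrongDirection) ∷ ((reduce mergedAvailable (contains 46)) , wrongDirection) ∷ ((reduce (merged (contains 25)) (contains 46)) , wrongDirection) ∷ ((reduce (merged (contains 27)) (contains 46)) , wrongDirection) ∷ []))
  ∷ (mkPattern 7 ((0 , 3) ∷ (0 , 4) ∷ (1 , 5) ∷ (2 , 6) ∷ (3 , 6) ∷ []) ((0 , 3) ∷ (3 , 6) ∷ []) , ((wrongDirection , (reduce (merged (contains 14)) (contains 47))) ∷ (wrongDirection , (reduce (merged (contains 17)) (contains 47))) ∷ (wrongDirection , (reduce mergedAvailable (contains 47))) ∷ (wrongDirection , wrongDirection) ∷ ((reduce mergedAvailable (contains 47)) , wrongDirection) ∷ ((reduce (merged (contains 26)) (contains 47)) , wrongDirection) ∷ ((reduce (merged (contains 27)) (contains 47)) , wrongDirection) ∷ []))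
  ∷ (mkPattern 7 ((0 , 3) ∷ (1 , 3) ∷ (1 , 4) ∷ (1 , 5) ∷ (2 , 6) ∷ []) ((1 , 3) ∷ (1 , 4) ∷ []) , ((wrongDirection , (reduce mergedAvailable (contains 48))) ∷ (wrongDirection , (reduce (merged (overloaded 1 2 3 4)) (contains 48))) ∷ (wrongDirection , (reduce (merged (contains 19)) (contains 48))) ∷ ((reduce (merged (contains 18)) (contains 48)) , wrongDirection) ∷ ((reduce mergedAvailable (contains 48)) , wrongDirection) ∷ ((reduce mergedAvailable (contains 48)) , wrongDirection) ∷ ((reduce (merged (contains 28)) (contains 48)) , wrongDirection) ∷ []))
  ∷ (mkPattern 7 ((0 , 3) ∷ (1 , 3) ∷ (1 , 4) ∷ (2 , 5) ∷ (2 , 6) ∷ []) ((1 , 3) ∷ (2 , 5) ∷ []) , ((wrongDirection , (reduce mergedAvailable (contains 49))) ∷ (wrongDirection , (reduce (merged (overloaded 1 2 3 4)) (contains 49))) ∷ (wrongDirection , (reduce (merged (overloaded 2 1 4 5)) (contains 49))) ∷ ((reduce (merged (overloaded 2 0 1 4)) (contains 49)) , wrongDirection) ∷ ((reduce mergedAvailable (contains 49)) , wrongDirection) ∷ ((reduce (merged (contains 8)) (contains 49)) , wrongDirection) ∷ ((reduce mergedAvailable (contains 49)) , wrongDirection) ∷ []))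
  ∷ (mkPattern 7 ((0 , 3) ∷ (1 , 3) ∷ (1 , 4) ∷ (2 , 5) ∷ (3 , 6) ∷ []) ((0 , 3) ∷ (1 , 3) ∷ []) , ((wrongDirection , (reduce mergedAvailable (contains 50))) ∷ (wrongDirection , (reduce (merged (contains 18)) (contains 50))) ∷ (wrongDirection , (reduce (merged (overloaded 2 0 1 4)) (contains 50))) ∷ (wrongDirection , wrongDirection) ∷ ((reduce mergedAvailable (contains 50)) , wrongDirection) ∷ ((reduce (merged (contains 29)) (contains 50)) , wrongDirection) ∷ ((reduce (merged (contains 9)) (contains 50)) , wrongDirection) ∷ []))
  ∷ (mkPattern 7 ((0 , 3) ∷ (1 , 3) ∷ (1 , 4) ∷ (2 , 5) ∷ (3 , 6) ∷ []) ((1 , 3) ∷ (3 , 6) ∷ []) , ((wrongDirection , (reduce mergedAvailable (contains 50))) ∷ (wrongDirection , (reduce (merged (contains 19)) (contains 51))) ∷ (wrongDirection , (reduce (merged (overloaded 2 1 4 5)) (contains 51))) ∷ (wrongDirection , wrongDirection) ∷ ((reduce mergedAvailable (contains 51)) , wrongDirection) ∷ ((reduce (merged (contains 30)) (contains 51)) , wrongDirection) ∷ ((reduce (merged (contains 9)) (contains 51)) , wrongDirection) ∷ []))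
  ∷ (mkPattern 7 ((0 , 3) ∷ (1 , 4) ∷ (1 , 5) ∷ (2 , 5) ∷ (2 , 6) ∷ []) ((1 , 4) ∷ (2 , 5) ∷ []) , ((wrongDirection , (reduce (merged (contains 12)) (contains 52))) ∷ (wrongDirection , (reduce mergedAvailable (contains 52))) ∷ (wrongDirection , (reduce (merged (contains 22)) (contains 52))) ∷ ((reduce (merged (contains 21)) (contains 52)) , wrongDirection) ∷ ((reduce (merged (contains 8)) (contains 52)) , wrongDirection) ∷ ((reduce mergedAvailable (contains 52)) , wrongDirection) ∷ ((reduce mergedAvailable (contains 52)) , wrongDirection) ∷ []))
  ∷ (mkPattern 7 ((0 , 3) ∷ (1 , 4) ∷ (1 , 5) ∷ (2 , 6) ∷ (3 , 6) ∷ []) ((1 , 4) ∷ (3 , 6) ∷ []) , ((wrongDirection , (reduce (merged (contains 14)) (contains 53))) ∷ (wrongDirection , (reduce (merged (contains 20)) (contains 53))) ∷ (wrongDirection , (reduce mergedAvailable (contains 53))) ∷ (wrongDirection , wrongDirection) ∷ ((reduce (merged (contains 9)) (contains 53)) , wrongDirection) ∷ ((reduce mergedAvailable (contains 53)) , wrongDirection) ∷ ((reduce (merged (contains 33)) (contains 53)) , wrongDirection) ∷ []))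
  ∷ (mkPattern 7 ((0 , 3) ∷ (1 , 4) ∷ (2 , 4) ∷ (2 , 5) ∷ (2 , 6) ∷ []) ((2 , 4) ∷ (2 , 5) ∷ []) , ((wrongDirection , (reduce (merged (contains 15)) (contains 54))) ∷ (wrongDirection , (reduce mergedAvailable (contains 54))) ∷ (wrongDirection , (reduce (merged (overloaded 2 3 4 5)) (contains 54))) ∷ ((reduce (merged (overloaded 2 0 3 4)) (contains 54)) , wrongDirection) ∷ ((reduce (merged (contains 31)) (contains 54)) , wrongDirection) ∷ ((reduce mergedAvailable (contains 54)) , wrongDirection) ∷ ((reduce mergedAvailable (contains 54)) , wrongDirection) ∷ []))
  ∷ (mkPattern 7 ((0 , 3) ∷ (1 , 4) ∷ (2 , 4) ∷ (2 , 5) ∷ (3 , 6) ∷ []) ((0 , 3) ∷ (2 , 4) ∷ []) , ((wrongDirection , (reduce (merged (contains 6)) (contains 55))) ∷ (wrongDirection , (reduce mergedAvailable (contains 55))) ∷ (wrongDirection , (reduce (merged (overloaded 2 0 3 4)) (contains 55))) ∷ (wrongDirection , wrongDirection) ∷ ((reduce (merged (overloaded 3 0 1 2)) (contains 55)) , wrongDirection) ∷ ((reduce mergedAvailable (contains 55)) , wrongDirection) ∷ ((reduce (merged (contains 10)) (contains 55)) , wrongDirection) ∷ []))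
  ∷ (mkPattern 7 ((0 , 3) ∷ (1 , 4) ∷ (2 , 4) ∷ (2 , 5) ∷ (3 , 6) ∷ []) ((2 , 4) ∷ (3 , 6) ∷ []) , ((wrongDirection , (reduce (merged (contains 6)) (contains 55))) ∷ (wrongDirection , (reduce mergedAvailable (contains 56))) ∷ (wrongDirection , (reduce (merged (overloaded 2 3 4 5)) (contains 56))) ∷ (wrongDirection , wrongDirection) ∷ ((reduce (merged (overloaded 3 1 2 5)) (contains 56)) , wrongDirection) ∷ ((reduce mergedAvailable (contains 56)) , wrongDirection) ∷ ((reduce (merged (contains 10)) (contains 56)) , wrongDirection) ∷ []))
  ∷ (mkPattern 7 ((0 , 3) ∷ (1 , 4) ∷ (2 , 5) ∷ (2 , 6) ∷ (3 , 6) ∷ []) ((2 , 5) ∷ (3 , 6) ∷ []) , ((wrongDirection , (reduce (merged (contains 17)) (contains 57))) ∷ (wrongDirection , (reduce (merged (contains 20)) (contains 57))) ∷ (wrongDirection , (reduce mergedAvailable (contains 57))) ∷ (wrongDirection , wrongDirection) ∷ ((reduce (merged (contains 32)) (contains 57)) , wrongDirection) ∷ ((reduce (merged (contains 10)) (contains 57)) , wrongDirection) ∷ ((reduce mergedAvailable (contains 57)) , wrongDirection) ∷ []))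
  ∷ (mkPattern 7 ((0 , 3) ∷ (1 , 4) ∷ (2 , 5) ∷ (3 , 5) ∷ (3 , 6) ∷ []) ((0 , 3) ∷ (3 , 5) ∷ []) , ((wrongDirection , (reduce (merged (contains 7)) (contains 58))) ∷ (wrongDirection , (reduce (merged (contains 21)) (contains 58))) ∷ (wrongDirection , (reduce mergedAvailable (contains 58))) ∷ (wrongDirection , wrongDirection) ∷ ((reduce (merged (overloaded 3 0 1 4)) (contains 58)) , wrongDirection) ∷ ((reduce (merged (contains 34)) (contains 58)) , wrongDirection) ∷ ((reduce mergedAvailable (contains 58)) , wrongDirection) ∷ []))
  ∷ (mkPattern 7 ((0 , 3) ∷ (1 , 4) ∷ (2 , 5) ∷ (3 , 5) ∷ (3 , 6) ∷ []) ((3 , 5) ∷ (3 , 6) ∷ []) , ((wrongDirection , (reduce (merged (contains 7)) (contains 58))) ∷ (wrongDirection , (reduce (merged (contains 22)) (contains 59))) ∷ (wrongDirection , (reduce mergedAvailable (contains 59))) ∷ (wrongDirection , wrongDirection) ∷ ((reduce (merged (overloaded 3 1 4 5)) (contains 59)) , wrongDirection) ∷ ((reduce (merged (contains 35)) (contains 59)) , wrongDirection) ∷ ((reduce mergedAvailable (contains 59)) , wrongDirection) ∷ []))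
  ∷ (mkPattern 7 ((0 , 4) ∷ (1 , 4) ∷ (1 , 5) ∷ (2 , 5) ∷ (3 , 6) ∷ []) ((1 , 4) ∷ (2 , 5) ∷ []) , ((wrongDirection , (reduce mergedAvailable (contains 60))) ∷ (wrongDirection , (reduce mergedAvailable (contains 60))) ∷ (wrongDirection , (reduce (merged (contains 8)) (contains 60))) ∷ (wrongDirection , (reduce (merged (contains 30)) (contains 60))) ∷ ((reduce (merged (contains 29)) (contains 60)) , wrongDirection) ∷ ((reduce mergedAvailable (contains 60)) , wrongDirection) ∷ ((reduce (merged (contains 36)) (contains 60)) , wrongDirection) ∷ []))
  ∷ (mkPattern 7 ((0 , 4) ∷ (1 , 4) ∷ (1 , 5) ∷ (2 , 6) ∷ (3 , 6) ∷ []) ((1 , 4) ∷ (3 , 6) ∷ []) , ((wrongDirection , (reduce mergedAvailable (contains 61))) ∷ (wrongDirection , (reduce (merged (contains 28)) (contains 61))) ∷ (wrongDirection , (reduce mergedAvailable (contains 61))) ∷ (wrongDirection , (reduce (merged (contains 9)) (contains 61))) ∷ ((reduce (merged (contains 9)) (contains 61)) , wrongDirection) ∷ ((reduce mergedAvailable (contains 61)) , wrongDirection) ∷ ((reduce (merged (contains 36)) (contains 61)) , wrongDirection) ∷ []))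
  ∷ (mkPattern 7 ((0 , 4) ∷ (1 , 4) ∷ (2 , 4) ∷ (2 , 5) ∷ (3 , 6) ∷ []) ((1 , 4) ∷ (2 , 4) ∷ []) , ((wrongDirection , (reduce mergedAvailable (contains 62))) ∷ (wrongDirection , (reduce mergedAvailable (contains 62))) ∷ (wrongDirection , (reduce (merged (contains 31)) (contains 62))) ∷ (wrongDirection , (reduce (merged (overloaded 3 1 2 5)) (contains 62))) ∷ ((reduce (merged (overloaded 3 0 1 2)) (contains 62)) , wrongDirection) ∷ ((reduce mergedAvailable (contains 62)) , wrongDirection) ∷ ((reduce (merged (contains 37)) (contains 62)) , wrongDirection) ∷ []))
  ∷ (mkPattern 7 ((0 , 4) ∷ (1 , 4) ∷ (2 , 5) ∷ (3 , 5) ∷ (3 , 6) ∷ []) ((1 , 4) ∷ (3 , 5) ∷ []) , ((wrongDirection , (reduce mergedAvailable (contains 63))) ∷ (wrongDirection , (reduce (merged (contains 8)) (contains 63))) ∷ (wrongDirection , (reduce mergedAvailable (contains 63))) ∷ (wrongDirection , (reduce (merged (overloaded 3 1 4 5)) (contains 63))) ∷ ((reduce (merged (overloaded 3 0 1 4)) (contains 63)) , wrongDirection) ∷ ((reduce (merged (overloaded 4 1 2 3)) (contains 63)) , wrongDirection) ∷ ((reduce mergedAvailable (contains 63)) , wrongDirection) ∷ []))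
  ∷ (mkPattern 7 ((0 , 4) ∷ (1 , 4) ∷ (2 , 5) ∷ (3 , 6) ∷ (4 , 6) ∷ []) ((1 , 4) ∷ (4 , 6) ∷ []) , ((wrongDirection , (reduce mergedAvailable (contains 64))) ∷ (wrongDirection , (reduce (merged (contains 9)) (contains 64))) ∷ (wrongDirection , (reduce (merged (contains 32)) (contains 64))) ∷ (wrongDirection , (reduce mergedAvailable (contains 64))) ∷ (wrongDirection , wrongDirection) ∷ ((reduce (merged (overloaded 4 1 2 5)) (contains 64)) , wrongDirection) ∷ ((reduce (merged (contains 38)) (contains 64)) , wrongDirection) ∷ []))
  ∷ (mkPattern 7 ((0 , 4) ∷ (1 , 5) ∷ (2 , 5) ∷ (2 , 6) ∷ (3 , 6) ∷ []) ((2 , 5) ∷ (3 , 6) ∷ []) , ((wrongDirection , (reduce (merged (contains 23)) (contains 65))) ∷ (wrongDirection , (reduce mergedAvailable (contains 65))) ∷ (wrongDirection , (reduce mergedAvailable (contains 65))) ∷ (wrongDirection , (reduce (merged (contains 10)) (contains 65))) ∷ ((reduce (merged (contains 10)) (contains 65)) , wrongDirection) ∷ ((reduce (merged (contains 37)) (contains 65)) , wrongDirection) ∷ ((reduce mergedAvailable (contains 65)) , wrongDirection) ∷ []))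
  ∷ (mkPattern 7 ((0 , 4) ∷ (1 , 5) ∷ (2 , 5) ∷ (3 , 5) ∷ (3 , 6) ∷ []) ((2 , 5) ∷ (3 , 5) ∷ []) , ((wrongDirection , (reduce (merged (contains 24)) (contains 66))) ∷ (wrongDirection , (reduce mergedAvailable (contains 66))) ∷ (wrongDirection , (reduce mergedAvailable (contains 66))) ∷ (wrongDirection , (reduce (merged (contains 35)) (contains 66))) ∷ ((reduce (merged (contains 34)) (contains 66)) , wrongDirection) ∷ ((reduce (merged (overloaded 4 1 2 3)) (contains 66)) , wrongDirection) ∷ ((reduce mergedAvailable (contains 66)) , wrongDirection) ∷ []))
  ∷ (mkPattern 7 ((0 , 4) ∷ (1 , 5) ∷ (2 , 5) ∷ (3 , 6) ∷ (4 , 6) ∷ []) ((2 , 5) ∷ (4 , 6) ∷ []) , ((wrongDirection , (reduce (merged (contains 26)) (contains 67))) ∷ (wrongDirection , (reduce mergedAvailable (contains 67))) ∷ (wrongDirection , (reduce (merged (contains 10)) (contains 67))) ∷ (wrongDirection , (reduce mergedAvailable (contains 67))) ∷ (wrongDirection , wrongDirection) ∷ ((reduce (merged (overloaded 4 1 2 5)) (contains 67)) , wrongDirection) ∷ ((reduce (merged (overloaded 5 2 3 4)) (contains 67)) , wrongDirection) ∷ []))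
  ∷ (mkPattern 7 ((0 , 4) ∷ (1 , 5) ∷ (2 , 6) ∷ (3 , 6) ∷ (4 , 6) ∷ []) ((3 , 6) ∷ (4 , 6) ∷ []) , ((wrongDirection , (reduce (merged (contains 27)) (contains 68))) ∷ (wrongDirection , (reduce (merged (contains 33)) (contains 68))) ∷ (wrongDirection , (reduce mergedAvailable (contains 68))) ∷ (wrongDirection , (reduce mergedAvailable (contains 68))) ∷ (wrongDirection , wrongDirection) ∷ ((reduce (merged (contains 38)) (contains 68)) , wrongDirection) ∷ ((reduce (merged (overloaded 5 2 3 4)) (contains 68)) , wrongDirection) ∷ []))
  ∷ (mkPattern 7 ((0 , 2) ∷ (0 , 3) ∷ (0 , 4) ∷ (1 , 5) ∷ (1 , 6) ∷ []) ((0 , 2) ∷ (0 , 3) ∷ (1 , 5) ∷ []) , ((wrongDirection , (reduce (merged (overloaded 0 1 2 3)) (contains 69))) ∷ (wrongDirection , (reduce (merged (contains 11)) (contains 69))) ∷ ((reduce (merged (contains 11)) (contains 69)) , wrongDirection) ∷ ((reduce mergedAvailable (contains 69)) , wrongDirection) ∷ ((reduce mergedAvailable (contains 69)) , wrongDirection) ∷ ((reduce (merged (contains 12)) (contains 69)) , wrongDirection) ∷ ((reduce mergedAvailable (contains 69)) , wrongDirection) ∷ []))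
  ∷ (mkPattern 7 ((0 , 2) ∷ (0 , 3) ∷ (1 , 4) ∷ (1 , 5) ∷ (1 , 6) ∷ []) ((0 , 2) ∷ (1 , 4) ∷ (1 , 5) ∷ []) , ((wrongDirection , (reduce (merged (overloaded 0 1 2 3)) (contains 70))) ∷ (wrongDirection , (reduce (merged (overloaded 1 0 3 4)) (contains 70))) ∷ ((reduce (merged (overloaded 1 0 3 4)) (contains 70)) , wrongDirection) ∷ ((reduce mergedAvailable (contains 70)) , wrongDirection) ∷ ((reduce (merged (contains 15)) (contains 70)) , wrongDirection) ∷ ((reduce mergedAvailable (contains 70)) , wrongDirection) ∷ ((reduce mergedAvailable (contains 70)) , wrongDirection) ∷ []))
  ∷ (mkPattern 7 ((0 , 2) ∷ (1 , 3) ∷ (1 , 4) ∷ (1 , 5) ∷ (2 , 6) ∷ []) ((0 , 2) ∷ (1 , 3) ∷ (1 , 4) ∷ []) , ((wrongDirection , (reduce (merged (overloaded 0 1 2 3)) (contains 71))) ∷ (wrongDirection , (reduce (merged (overloaded 1 0 2 3)) (contains 71))) ∷ (wrongDirection , wrongDirection) ∷ ((reduce (merged (contains 18)) (contains 71)) , wrongDirection) ∷ ((reduce mergedAvailable (contains 71)) , wrongDirection) ∷ ((reduce mergedAvailable (contains 71)) , wrongDirection) ∷ ((reduce (merged (contains 20)) (contains 71)) , wrongDirection) ∷ []))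
  ∷ (mkPattern 7 ((0 , 2) ∷ (1 , 3) ∷ (1 , 4) ∷ (1 , 5) ∷ (2 , 6) ∷ []) ((1 , 3) ∷ (1 , 4) ∷ (2 , 6) ∷ []) , ((wrongDirection , (reduce (merged (overloaded 0 1 2 3)) (contains 71))) ∷ (wrongDirection , (reduce (merged (overloaded 1 2 3 4)) (contains 72))) ∷ (wrongDirection , wrongDirection) ∷ ((reduce (merged (contains 19)) (contains 72)) , wrongDirection) ∷ ((reduce mergedAvailable (contains 72)) , wrongDirection) ∷ ((reduce mergedAvailable (contains 72)) , wrongDirection) ∷ ((reduce (merged (contains 20)) (contains 72)) , wrongDirection) ∷ []))
  ∷ (mkPattern 7 ((0 , 2) ∷ (1 , 3) ∷ (1 , 4) ∷ (2 , 5) ∷ (2 , 6) ∷ []) ((0 , 2) ∷ (1 , 3) ∷ (2 , 5) ∷ []) , ((wrongDirection , (reduce (merged (contains 11)) (contains 73))) ∷ (wrongDirection , (reduce (merged (overloaded 1 0 2 3)) (contains 73))) ∷ (wrongDirection , wrongDirection) ∷ ((reduce (merged (overloaded 2 0 1 4)) (contains 73)) , wrongDirection) ∷ ((reduce mergedAvailable (contains 73)) , wrongDirection) ∷ ((reduce (merged (contains 21)) (contains 73)) , wrongDirection) ∷ ((reduce mergedAvailable (contains 73)) , wrongDirection) ∷ []))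
  ∷ (mkPattern 7 ((0 , 2) ∷ (1 , 3) ∷ (1 , 4) ∷ (2 , 5) ∷ (2 , 6) ∷ []) ((1 , 3) ∷ (2 , 5) ∷ (2 , 6) ∷ []) , ((wrongDirection , (reduce (merged (contains 11)) (contains 73))) ∷ (wrongDirection , (reduce (merged (overloaded 1 2 3 4)) (contains 74))) ∷ (wrongDirection , wrongDirection) ∷ ((reduce (merged (overloaded 2 1 4 5)) (contains 74)) , wrongDirection) ∷ ((reduce mergedAvailable (contains 74)) , wrongDirection) ∷ ((reduce (merged (contains 22)) (contains 74)) , wrongDirection) ∷ ((reduce mergedAvailable (contains 74)) , wrongDirection) ∷ []))
  ∷ (mkPattern 7 ((0 , 3) ∷ (0 , 4) ∷ (0 , 5) ∷ (1 , 5) ∷ (2 , 6) ∷ []) ((0 , 3) ∷ (0 , 4) ∷ (1 , 5) ∷ []) , ((wrongDirection , (reduce mergedAvailable (contains 75))) ∷ (wrongDirection , (reduce (merged (contains 12)) (contains 75))) ∷ (wrongDirection , (reduce (merged (contains 13)) (contains 75))) ∷ ((reduce (merged (contains 13)) (contains 75)) , wrongDirection) ∷ ((reduce mergedAvailable (contains 75)) , wrongDirection) ∷ ((reduce mergedAvailable (contains 75)) , wrongDirection) ∷ ((reduce (merged (contains 39)) (contains 75)) , wrongDirection) ∷ []))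
  ∷ (mkPattern 7 ((0 , 3) ∷ (0 , 4) ∷ (0 , 5) ∷ (1 , 6) ∷ (2 , 6) ∷ []) ((0 , 3) ∷ (0 , 4) ∷ (2 , 6) ∷ []) , ((wrongDirection , (reduce (merged (overloaded 0 2 3 4)) (contains 76))) ∷ (wrongDirection , (reduce mergedAvailable (contains 76))) ∷ (wrongDirection , (reduce (merged (contains 14)) (contains 76))) ∷ ((reduce (merged (contains 14)) (contains 76)) , wrongDirection) ∷ ((reduce mergedAvailable (contains 76)) , wrongDirection) ∷ ((reduce mergedAvailable (contains 76)) , wrongDirection) ∷ ((reduce (merged (contains 39)) (contains 76)) , wrongDirection) ∷ []))
  ∷ (mkPattern 7 ((0 , 3) ∷ (0 , 4) ∷ (1 , 4) ∷ (2 , 5) ∷ (2 , 6) ∷ []) ((0 , 3) ∷ (1 , 4) ∷ (2 , 5) ∷ []) , ((wrongDirection , (reduce mergedAvailable (contains 77))) ∷ (wrongDirection , (reduce (merged (contains 15)) (contains 77))) ∷ (wrongDirection , (reduce (merged (contains 16)) (contains 77))) ∷ ((reduce (merged (contains 16)) (contains 77)) , wrongDirection) ∷ ((reduce mergedAvailable (contains 77)) , wrongDirection) ∷ ((reduce (merged (contains 24)) (contains 77)) , wrongDirection) ∷ ((reduce mergedAvailable (contains 77)) , wrongDirection) ∷ []))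
  ∷ (mkPattern 7 ((0 , 3) ∷ (0 , 4) ∷ (1 , 5) ∷ (1 , 6) ∷ (2 , 6) ∷ []) ((0 , 3) ∷ (1 , 5) ∷ (2 , 6) ∷ []) , ((wrongDirection , (reduce (merged (overloaded 0 2 3 4)) (contains 78))) ∷ (wrongDirection , (reduce mergedAvailable (contains 78))) ∷ (wrongDirection , (reduce (merged (contains 17)) (contains 78))) ∷ ((reduce (merged (contains 17)) (contains 78)) , wrongDirection) ∷ ((reduce mergedAvailable (contains 78)) , wrongDirection) ∷ ((reduce (merged (contains 23)) (contains 78)) , wrongDirection) ∷ ((reduce mergedAvailable (contains 78)) , wrongDirection) ∷ []))
  ∷ (mkPattern 7 ((0 , 3) ∷ (1 , 3) ∷ (2 , 4) ∷ (2 , 5) ∷ (2 , 6) ∷ []) ((1 , 3) ∷ (2 , 4) ∷ (2 , 5) ∷ []) , ((wrongDirection , (reduce mergedAvailable (contains 79))) ∷ (wrongDirection , (reduce (merged (overloaded 1 2 3 4)) (contains 79))) ∷ (wrongDirection , (reduce (merged (overloaded 2 1 3 4)) (contains 79))) ∷ ((reduce (merged (overloaded 2 0 1 3)) (contains 79)) , wrongDirection) ∷ ((reduce (merged (contains 31)) (contains 79)) , wrongDirection) ∷ ((reduce mergedAvailable (contains 79)) , wrongDirection) ∷ ((reduce mergedAvailable (contains 79)) , wrongDirection) ∷ []))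
  ∷ (mkPattern 7 ((0 , 3) ∷ (1 , 3) ∷ (2 , 4) ∷ (2 , 5) ∷ (3 , 6) ∷ []) ((0 , 3) ∷ (1 , 3) ∷ (2 , 4) ∷ []) , ((wrongDirection , (reduce mergedAvailable (contains 80))) ∷ (wrongDirection , (reduce (merged (contains 18)) (contains 80))) ∷ (wrongDirection , (reduce (merged (overloaded 2 0 1 3)) (contains 80))) ∷ (wrongDirection , wrongDirection) ∷ ((reduce (merged (overloaded 3 0 1 2)) (contains 80)) , wrongDirection) ∷ ((reduce mergedAvailable (contains 80)) , wrongDirection) ∷ ((reduce (merged (contains 32)) (contains 80)) , wrongDirection) ∷ []))
  ∷ (mkPattern 7 ((0 , 3) ∷ (1 , 3) ∷ (2 , 4) ∷ (2 , 5) ∷ (3 , 6) ∷ []) ((1 , 3) ∷ (2 , 4) ∷ (3 , 6) ∷ []) , ((wrongDirection , (reduce mergedAvailable (contains 80))) ∷ (wrongDirection , (reduce (merged (contains 19)) (contains 81))) ∷ (wrongDirection , (reduce (merged (overloaded 2 1 3 4)) (contains 81))) ∷ (wrongDirection , wrongDirection) ∷ ((reduce (merged (overloaded 3 1 2 5)) (contains 81)) , wrongDirection) ∷ ((reduce mergedAvailable (contains 81)) , wrongDirection) ∷ ((reduce (merged (contains 32)) (contains 81)) , wrongDirection) ∷ []))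
  ∷ (mkPattern 7 ((0 , 3) ∷ (1 , 4) ∷ (1 , 5) ∷ (1 , 6) ∷ (2 , 6) ∷ []) ((1 , 4) ∷ (1 , 5) ∷ (2 , 6) ∷ []) , ((wrongDirection , (reduce (merged (overloaded 0 2 3 4)) (contains 82))) ∷ (wrongDirection , (reduce mergedAvailable (contains 82))) ∷ (wrongDirection , (reduce (merged (contains 20)) (contains 82))) ∷ ((reduce (merged (contains 20)) (contains 82)) , wrongDirection) ∷ ((reduce (merged (contains 28)) (contains 82)) , wrongDirection) ∷ ((reduce mergedAvailable (contains 82)) , wrongDirection) ∷ ((reduce mergedAvailable (contains 82)) , wrongDirection) ∷ []))
  ∷ (mkPattern 7 ((0 , 3) ∷ (1 , 4) ∷ (1 , 5) ∷ (2 , 5) ∷ (3 , 6) ∷ []) ((0 , 3) ∷ (1 , 4) ∷ (2 , 5) ∷ []) , ((wrongDirection , (reduce (merged (contains 13)) (contains 83))) ∷ (wrongDirection , (reduce mergedAvailable (contains 83))) ∷ (wrongDirection , (reduce (merged (contains 21)) (contains 83))) ∷ (wrongDirection , wrongDirection) ∷ ((reduce (merged (contains 29)) (contains 83)) , wrongDirection) ∷ ((reduce mergedAvailable (contains 83)) , wrongDirection) ∷ ((reduce (merged (contains 33)) (contains 83)) , wrongDirection) ∷ []))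
  ∷ (mkPattern 7 ((0 , 3) ∷ (1 , 4) ∷ (1 , 5) ∷ (2 , 5) ∷ (3 , 6) ∷ []) ((1 , 4) ∷ (2 , 5) ∷ (3 , 6) ∷ []) , ((wrongDirection , (reduce (merged (contains 13)) (contains 83))) ∷ (wrongDirection , (reduce mergedAvailable (contains 84))) ∷ (wrongDirection , (reduce (merged (contains 22)) (contains 84))) ∷ (wrongDirection , wrongDirection) ∷ ((reduce (merged (contains 30)) (contains 84)) , wrongDirection) ∷ ((reduce mergedAvailable (contains 84)) , wrongDirection) ∷ ((reduce (merged (contains 33)) (contains 84)) , wrongDirection) ∷ []))
  ∷ (mkPattern 7 ((0 , 3) ∷ (1 , 4) ∷ (2 , 4) ∷ (3 , 5) ∷ (3 , 6) ∷ []) ((0 , 3) ∷ (2 , 4) ∷ (3 , 5) ∷ []) , ((wrongDirection , (reduce (merged (contains 16)) (contains 85))) ∷ (wrongDirection , (reduce mergedAvailable (contains 85))) ∷ (wrongDirection , (reduce (merged (overloaded 2 0 3 4)) (contains 85))) ∷ (wrongDirection , wrongDirection) ∷ ((reduce (merged (overloaded 3 0 1 2)) (contains 85)) , wrongDirection) ∷ ((reduce (merged (contains 34)) (contains 85)) , wrongDirection) ∷ ((reduce mergedAvailable (contains 85)) , wrongDirection) ∷ []))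
  ∷ (mkPattern 7 ((0 , 3) ∷ (1 , 4) ∷ (2 , 4) ∷ (3 , 5) ∷ (3 , 6) ∷ []) ((2 , 4) ∷ (3 , 5) ∷ (3 , 6) ∷ []) , ((wrongDirection , (reduce (merged (contains 16)) (contains 85))) ∷ (wrongDirection , (reduce mergedAvailable (contains 86))) ∷ (wrongDirection , (reduce (merged (overloaded 2 3 4 5)) (contains 86))) ∷ (wrongDirection , wrongDirection) ∷ ((reduce (merged (overloaded 3 1 2 4)) (contains 86)) , wrongDirection) ∷ ((reduce (merged (contains 35)) (contains 86)) , wrongDirection) ∷ ((reduce mergedAvailable (contains 86)) , wrongDirection) ∷ []))
  ∷ (mkPattern 7 ((0 , 4) ∷ (0 , 5) ∷ (1 , 5) ∷ (2 , 5) ∷ (3 , 6) ∷ []) ((0 , 4) ∷ (1 , 5) ∷ (2 , 5) ∷ []) , ((wrongDirection , (reduce mergedAvailable (contains 87))) ∷ (wrongDirection , (reduce mergedAvailable (contains 87))) ∷ (wrongDirection , (reduce (merged (contains 24)) (contains 87))) ∷ (wrongDirection , (reduce (merged (contains 25)) (contains 87))) ∷ ((reduce (merged (contains 25)) (contains 87)) , wrongDirection) ∷ ((reduce mergedAvailable (contains 87)) , wrongDirection) ∷ ((reduce (merged (overloaded 5 1 2 3)) (contains 87)) , wrongDirection) ∷ []))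
  ∷ (mkPattern 7 ((0 , 4) ∷ (0 , 5) ∷ (1 , 5) ∷ (2 , 6) ∷ (3 , 6) ∷ []) ((0 , 4) ∷ (1 , 5) ∷ (3 , 6) ∷ []) , ((wrongDirection , (reduce mergedAvailable (contains 88))) ∷ (wrongDirection , (reduce (merged (contains 23)) (contains 88))) ∷ (wrongDirection , (reduce mergedAvailable (contains 88))) ∷ (wrongDirection , (reduce (merged (contains 26)) (contains 88))) ∷ ((reduce (merged (contains 26)) (contains 88)) , wrongDirection) ∷ ((reduce mergedAvailable (contains 88)) , wrongDirection) ∷ ((reduce (merged (overloaded 5 1 2 3)) (contains 88)) , wrongDirection) ∷ []))
  ∷ (mkPattern 7 ((0 , 4) ∷ (0 , 5) ∷ (1 , 6) ∷ (2 , 6) ∷ (3 , 6) ∷ []) ((0 , 4) ∷ (2 , 6) ∷ (3 , 6) ∷ []) , ((wrongDirection , (reduce (merged (contains 39)) (contains 89))) ∷ (wrongDirection , (reduce mergedAvailable (contains 89))) ∷ (wrongDirection , (reduce mergedAvailable (contains 89))) ∷ (wrongDirection , (reduce (merged (contains 27)) (contains 89))) ∷ ((reduce (merged (contains 27)) (contains 89)) , wrongDirection) ∷ ((reduce mergedAvailable (contains 89)) , wrongDirection) ∷ ((reduce (merged (overloaded 5 1 2 3)) (contains 89)) , wrongDirection) ∷ []))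
  ∷ (mkPattern 7 ((0 , 4) ∷ (1 , 4) ∷ (2 , 4) ∷ (3 , 5) ∷ (3 , 6) ∷ []) ((1 , 4) ∷ (2 , 4) ∷ (3 , 5) ∷ []) , ((wrongDirection , (reduce mergedAvailable (contains 90))) ∷ (wrongDirection , (reduce mergedAvailable (contains 90))) ∷ (wrongDirection , (reduce (merged (contains 31)) (contains 90))) ∷ (wrongDirection , (reduce (merged (overloaded 3 1 2 4)) (contains 90))) ∷ ((reduce (merged (overloaded 3 0 1 2)) (contains 90)) , wrongDirection) ∷ ((reduce (merged (overloaded 4 1 2 3)) (contains 90)) , wrongDirection) ∷ ((reduce mergedAvailable (contains 90)) , wrongDirection) ∷ []))
  ∷ (mkPattern 7 ((0 , 4) ∷ (1 , 4) ∷ (2 , 5) ∷ (2 , 6) ∷ (3 , 6) ∷ []) ((1 , 4) ∷ (2 , 5) ∷ (3 , 6) ∷ []) , ((wrongDirection , (reduce mergedAvailable (contains 91))) ∷ (wrongDirection , (reduce (merged (contains 28)) (contains 91))) ∷ (wrongDirection , (reduce mergedAvailable (contains 91))) ∷ (wrongDirection , (reduce (merged (contains 32)) (contains 91))) ∷ ((reduce (merged (contains 32)) (contains 91)) , wrongDirection) ∷ ((reduce (merged (contains 37)) (contains 91)) , wrongDirection) ∷ ((reduce mergedAvailable (contains 91)) , wrongDirection) ∷ []))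
  ∷ (mkPattern 7 ((0 , 4) ∷ (1 , 4) ∷ (2 , 5) ∷ (3 , 5) ∷ (4 , 6) ∷ []) ((0 , 4) ∷ (1 , 4) ∷ (3 , 5) ∷ []) , ((wrongDirection , (reduce mergedAvailable (contains 92))) ∷ (wrongDirection , (reduce (merged (contains 29)) (contains 92))) ∷ (wrongDirection , (reduce mergedAvailable (contains 92))) ∷ (wrongDirection , (reduce (merged (overloaded 3 0 1 4)) (contains 92))) ∷ (wrongDirection , wrongDirection) ∷ ((reduce (merged (overloaded 4 0 1 2)) (contains 92)) , wrongDirection) ∷ ((reduce (merged (contains 38)) (contains 92)) , wrongDirection) ∷ []))
  ∷ (mkPattern 7 ((0 , 4) ∷ (1 , 4) ∷ (2 , 5) ∷ (3 , 5) ∷ (4 , 6) ∷ []) ((1 , 4) ∷ (3 , 5) ∷ (4 , 6) ∷ []) , ((wrongDirection , (reduce mergedAvailable (contains 92))) ∷ (wrongDirection , (reduce (merged (contains 30)) (contains 93))) ∷ (wrongDirection , (reduce mergedAvailable (contains 93))) ∷ (wrongDirection , (reduce (merged (overloaded 3 1 4 5)) (contains 93))) ∷ (wrongDirection , wrongDirection) ∷ ((reduce (merged (overloaded 4 1 2 3)) (contains 93)) , wrongDirection) ∷ ((reduce (merged (contains 38)) (contains 93)) , wrongDirection) ∷ []))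
  ∷ (mkPattern 7 ((0 , 4) ∷ (1 , 5) ∷ (1 , 6) ∷ (2 , 6) ∷ (3 , 6) ∷ []) ((1 , 5) ∷ (2 , 6) ∷ (3 , 6) ∷ []) , ((wrongDirection , (reduce (merged (contains 39)) (contains 94))) ∷ (wrongDirection , (reduce mergedAvailable (contains 94))) ∷ (wrongDirection , (reduce mergedAvailable (contains 94))) ∷ (wrongDirection , (reduce (merged (contains 33)) (contains 94))) ∷ ((reduce (merged (contains 33)) (contains 94)) , wrongDirection) ∷ ((reduce (merged (contains 36)) (contains 94)) , wrongDirection) ∷ ((reduce mergedAvailable (contains 94)) , wrongDirection) ∷ []))
  ∷ (mkPattern 7 ((0 , 4) ∷ (1 , 5) ∷ (2 , 5) ∷ (3 , 5) ∷ (4 , 6) ∷ []) ((0 , 4) ∷ (2 , 5) ∷ (3 , 5) ∷ []) , ((wrongDirection , (reduce (merged (contains 25)) (contains 95))) ∷ (wrongDirection , (reduce mergedAvailable (contains 95))) ∷ (wrongDirection , (reduce mergedAvailable (contains 95))) ∷ (wrongDirection , (reduce (merged (contains 34)) (contains 95))) ∷ (wrongDirection , wrongDirection) ∷ ((reduce (merged (overloaded 4 0 1 2)) (contains 95)) , wrongDirection) ∷ ((reduce (merged (overloaded 5 2 3 4)) (contains 95)) , wrongDirection) ∷ []))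
  ∷ (mkPattern 7 ((0 , 4) ∷ (1 , 5) ∷ (2 , 5) ∷ (3 , 5) ∷ (4 , 6) ∷ []) ((2 , 5) ∷ (3 , 5) ∷ (4 , 6) ∷ []) , ((wrongDirection , (reduce (merged (contains 25)) (contains 95))) ∷ (wrongDirection , (reduce mergedAvailable (contains 96))) ∷ (wrongDirection , (reduce mergedAvailable (contains 96))) ∷ (wrongDirection , (reduce (merged (contains 35)) (contains 96))) ∷ (wrongDirection , wrongDirection) ∷ ((reduce (merged (overloaded 4 1 2 3)) (contains 96)) , wrongDirection) ∷ ((reduce (merged (overloaded 5 2 3 4)) (contains 96)) , wrongDirection) ∷ []))
  ∷ (mkPattern 7 ((0 , 5) ∷ (1 , 5) ∷ (2 , 5) ∷ (3 , 6) ∷ (4 , 6) ∷ []) ((1 , 5) ∷ (2 , 5) ∷ (4 , 6) ∷ []) , ((wrongDirection , (reduce mergedAvailable (contains 97))) ∷ (wrongDirection , (reduce mergedAvailable (contains 97))) ∷ (wrongDirection , (reduce (merged (contains 37)) (contains 97))) ∷ (wrongDirection , (reduce mergedAvailable (contains 97))) ∷ (wrongDirection , (reduce (merged (overloaded 4 1 2 5)) (contains 97))) ∷ ((reduce (merged (overloaded 4 0 1 2)) (contains 97)) , wrongDirection) ∷ ((reduce (merged (overloaded 5 1 2 3)) (contains 97)) , wrongDirection) ∷ []))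
  ∷ (mkPattern 7 ((0 , 5) ∷ (1 , 5) ∷ (2 , 6) ∷ (3 , 6) ∷ (4 , 6) ∷ []) ((1 , 5) ∷ (3 , 6) ∷ (4 , 6) ∷ []) , ((wrongDirection , (reduce mergedAvailable (contains 98))) ∷ (wrongDirection , (reduce (merged (contains 36)) (contains 98))) ∷ (wrongDirection , (reduce mergedAvailable (contains 98))) ∷ (wrongDirection , (reduce mergedAvailable (contains 98))) ∷ (wrongDirection , (reduce (merged (contains 38)) (contains 98))) ∷ ((reduce (merged (contains 38)) (contains 98)) , wrongDirection) ∷ ((reduce (merged (overloaded 5 1 2 3)) (contains 98)) , wrongDirection) ∷ []))
  ∷ (mkPattern 8 ((0 , 3) ∷ (0 , 4) ∷ (1 , 5) ∷ (2 , 6) ∷ (3 , 7) ∷ []) ((0 , 3) ∷ []) , ((wrongDirection , (reduce (merged (contains 40)) (contains 99))) ∷ (wrongDirection , (reduce (merged (contains 41)) (contains 99))) ∷ (wrongDirection , (reduce (merged (contains 42)) (contains 99))) ∷ (wrongDirection , wrongDirection) ∷ ((reduce mergedAvailable (contains 99)) , wrongDirection) ∷ ((reduce (merged (contains 44)) (contains 99)) , wrongDirection) ∷ ((reduce (merged (contains 46)) (contains 99)) , wrongDirection) ∷ ((reduce (merged (contains 47)) (contains 99)) , wrongDirection) ∷ []))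
  ∷ (mkPattern 8 ((0 , 4) ∷ (1 , 4) ∷ (1 , 5) ∷ (2 , 6) ∷ (3 , 7) ∷ []) ((1 , 4) ∷ []) , ((wrongDirection , (reduce mergedAvailable (contains 100))) ∷ (wrongDirection , (reduce (merged (contains 48)) (contains 100))) ∷ (wrongDirection , (reduce (merged (contains 49)) (contains 100))) ∷ (wrongDirection , (reduce (merged (contains 51)) (contains 100))) ∷ ((reduce (merged (contains 50)) (contains 100)) , wrongDirection) ∷ ((reduce mergedAvailable (contains 100)) , wrongDirection) ∷ ((reduce (merged (contains 60)) (contains 100)) , wrongDirection) ∷ ((reduce (merged (contains 61)) (contains 100)) , wrongDirection) ∷ []))
  ∷ (mkPattern 8 ((0 , 4) ∷ (1 , 5) ∷ (2 , 5) ∷ (2 , 6) ∷ (3 , 7) ∷ []) ((2 , 5) ∷ []) , ((wrongDirection , (reduce (merged (contains 43)) (contains 101))) ∷ (wrongDirection , (reduce mergedAvailable (contains 101))) ∷ (wrongDirection , (reduce (merged (contains 54)) (contains 101))) ∷ (wrongDirection , (reduce (merged (contains 56)) (contains 101))) ∷ ((reduce (merged (contains 55)) (contains 101)) , wrongDirection) ∷ ((reduce (merged (contains 62)) (contains 101)) , wrongDirection) ∷ ((reduce mergedAvailable (contains 101)) , wrongDirection) ∷ ((reduce (merged (contains 65)) (contains 101)) , wrongDirection) ∷ []))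
  ∷ (mkPattern 8 ((0 , 4) ∷ (1 , 5) ∷ (2 , 6) ∷ (3 , 6) ∷ (3 , 7) ∷ []) ((3 , 6) ∷ []) , ((wrongDirection , (reduce (merged (contains 45)) (contains 102))) ∷ (wrongDirection , (reduce (merged (contains 52)) (contains 102))) ∷ (wrongDirection , (reduce mergedAvailable (contains 102))) ∷ (wrongDirection , (reduce (merged (contains 59)) (contains 102))) ∷ ((reduce (merged (contains 58)) (contains 102)) , wrongDirection) ∷ ((reduce (merged (contains 63)) (contains 102)) , wrongDirection) ∷ ((reduce (merged (contains 66)) (contains 102)) , wrongDirection) ∷ ((reduce mergedAvailable (contains 102)) , wrongDirection) ∷ []))
  ∷ (mkPattern 8 ((0 , 4) ∷ (1 , 5) ∷ (2 , 6) ∷ (3 , 7) ∷ (4 , 7) ∷ []) ((4 , 7) ∷ []) , ((wrongDirection , (reduce (merged (contains 47)) (contains 103))) ∷ (wrongDirection , (reduce (merged (contains 53)) (contains 103))) ∷ (wrongDirection , (reduce (merged (contains 57)) (contains 103))) ∷ (wrongDirection , (reduce mergedAvailable (contains 103))) ∷ (wrongDirection , wrongDirection) ∷ ((reduce (merged (contains 64)) (contains 103)) , wrongDirection) ∷ ((reduce (merged (contains 67)) (contains 103)) , wrongDirection) ∷ ((reduce (merged (contains 68)) (contains 103)) , wrongDirection) ∷ []))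
  ∷ (mkPattern 8 ((0 , 3) ∷ (0 , 4) ∷ (0 , 5) ∷ (1 , 6) ∷ (2 , 7) ∷ []) ((0 , 3) ∷ (0 , 4) ∷ []) , ((wrongDirection , (reduce (merged (overloaded 0 2 3 4)) (contains 104))) ∷ (wrongDirection , (reduce (merged (contains 69)) (contains 104))) ∷ (wrongDirection , (reduce (merged (contains 40)) (contains 104))) ∷ ((reduce (merged (contains 40)) (contains 104)) , wrongDirection) ∷ ((reduce mergedAvailable (contains 104)) , wrongDirection) ∷ ((reduce mergedAvailable (contains 104)) , wrongDirection) ∷ ((reduce (merged (contains 75)) (contains 104)) , wrongDirection) ∷ ((reduce (merged (contains 76)) (contains 104)) , wrongDirection) ∷ []))
  ∷ (mkPattern 8 ((0 , 3) ∷ (0 , 4) ∷ (1 , 5) ∷ (1 , 6) ∷ (2 , 7) ∷ []) ((0 , 3) ∷ (1 , 5) ∷ []) , ((wrongDirection , (reduce (merged (overloaded 0 2 3 4)) (contains 105))) ∷ (wrongDirection , (reduce (merged (contains 70)) (contains 105))) ∷ (wrongDirection , (reduce (merged (contains 41)) (contains 105))) ∷ ((reduce (merged (contains 41)) (contains 105)) , wrongDirection) ∷ ((reduce mergedAvailable (contains 105)) , wrongDirection) ∷ ((reduce (merged (contains 43)) (contains 105)) , wrongDirection) ∷ ((reduce mergedAvailable (contains 105)) , wrongDirection) ∷ ((reduce (merged (contains 78)) (contains 105)) , wrongDirection) ∷ []))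
  ∷ (mkPattern 8 ((0 , 3) ∷ (0 , 4) ∷ (1 , 5) ∷ (2 , 6) ∷ (2 , 7) ∷ []) ((0 , 3) ∷ (2 , 6) ∷ []) , ((wrongDirection , (reduce (merged (contains 69)) (contains 106))) ∷ (wrongDirection , (reduce (merged (contains 70)) (contains 106))) ∷ (wrongDirection , (reduce (merged (contains 42)) (contains 106))) ∷ ((reduce (merged (contains 42)) (contains 106)) , wrongDirection) ∷ ((reduce mergedAvailable (contains 106)) , wrongDirection) ∷ ((reduce (merged (contains 77)) (contains 106)) , wrongDirection) ∷ ((reduce (merged (contains 45)) (contains 106)) , wrongDirection) ∷ ((reduce mergedAvailable (contains 106)) , wrongDirection) ∷ []))
  ∷ (mkPattern 8 ((0 , 3) ∷ (1 , 4) ∷ (1 , 5) ∷ (1 , 6) ∷ (2 , 7) ∷ []) ((1 , 4) ∷ (1 , 5) ∷ []) , ((wrongDirection , (reduce (merged (overloaded 0 2 3 4)) (contains 107))) ∷ (wrongDirection , (reduce (merged (overloaded 1 3 4 5)) (contains 107))) ∷ (wrongDirection , (reduce (merged (contains 72)) (contains 107))) ∷ ((reduce (merged (contains 71)) (contains 107)) , wrongDirection) ∷ ((reduce (merged (contains 48)) (contains 107)) , wrongDirection) ∷ ((reduce mergedAvailable (contains 107)) , wrongDirection) ∷ ((reduce mergedAvailable (contains 107)) , wrongDirection) ∷ ((reduce (merged (contains 82)) (contains 107)) , wrongDirection) ∷ []))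
  ∷ (mkPattern 8 ((0 , 3) ∷ (1 , 4) ∷ (1 , 5) ∷ (2 , 6) ∷ (2 , 7) ∷ []) ((1 , 4) ∷ (2 , 6) ∷ []) , ((wrongDirection , (reduce (merged (contains 69)) (contains 108))) ∷ (wrongDirection , (reduce (merged (overloaded 1 3 4 5)) (contains 108))) ∷ (wrongDirection , (reduce (merged (contains 74)) (contains 108))) ∷ ((reduce (merged (contains 73)) (contains 108)) , wrongDirection) ∷ ((reduce (merged (contains 49)) (contains 108)) , wrongDirection) ∷ ((reduce mergedAvailable (contains 108)) , wrongDirection) ∷ ((reduce (merged (contains 52)) (contains 108)) , wrongDirection) ∷ ((reduce mergedAvailable (contains 108)) , wrongDirection) ∷ []))
  ∷ (mkPattern 8 ((0 , 3) ∷ (1 , 4) ∷ (1 , 5) ∷ (2 , 6) ∷ (3 , 7) ∷ []) ((0 , 3) ∷ (1 , 4) ∷ []) , ((wrongDirection , (reduce (merged (contains 40)) (contains 109))) ∷ (wrongDirection , (reduce (merged (contains 71)) (contains 109))) ∷ (wrongDirection , (reduce (merged (contains 73)) (contains 109))) ∷ (wrongDirection , wrongDirection) ∷ ((reduce (merged (contains 50)) (contains 109)) , wrongDirection) ∷ ((reduce mergedAvailable (contains 109)) , wrongDirection) ∷ ((reduce (merged (contains 83)) (contains 109)) , wrongDirection) ∷ ((reduce (merged (contains 53)) (contains 109)) , wrongDirection) ∷ []))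
  ∷ (mkPattern 8 ((0 , 3) ∷ (1 , 4) ∷ (1 , 5) ∷ (2 , 6) ∷ (3 , 7) ∷ []) ((1 , 4) ∷ (3 , 7) ∷ []) , ((wrongDirection , (reduce (merged (contains 40)) (contains 109))) ∷ (wrongDirection , (reduce (merged (contains 72)) (contains 110))) ∷ (wrongDirection , (reduce (merged (contains 74)) (contains 110))) ∷ (wrongDirection , wrongDirection) ∷ ((reduce (merged (contains 51)) (contains 110)) , wrongDirection) ∷ ((reduce mergedAvailable (contains 110)) , wrongDirection) ∷ ((reduce (merged (contains 84)) (contains 110)) , wrongDirection) ∷ ((reduce (merged (contains 53)) (contains 110)) , wrongDirection) ∷ []))
  ∷ (mkPattern 8 ((0 , 3) ∷ (1 , 4) ∷ (2 , 5) ∷ (2 , 6) ∷ (2 , 7) ∷ []) ((2 , 5) ∷ (2 , 6) ∷ []) , ((wrongDirection , (reduce (merged (contains 70)) (contains 111))) ∷ (wrongDirection , (reduce (merged (overloaded 1 3 4 5)) (contains 111))) ∷ (wrongDirection , (reduce (merged (overloaded 2 4 5 6)) (contains 111))) ∷ ((reduce (merged (overloaded 2 0 4 5)) (contains 111)) , wrongDirection) ∷ ((reduce (merged (contains 79)) (contains 111)) , wrongDirection) ∷ ((reduce (merged (contains 54)) (contains 111)) , wrongDirection) ∷ ((reduce mergedAvailable (contains 111)) , wrongDirection) ∷ ((reduce mergedAvailable (contains 111)) , wrongDirection) ∷ []))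
  ∷ (mkPattern 8 ((0 , 3) ∷ (1 , 4) ∷ (2 , 5) ∷ (2 , 6) ∷ (3 , 7) ∷ []) ((0 , 3) ∷ (2 , 5) ∷ []) , ((wrongDirection , (reduce (merged (contains 41)) (contains 112))) ∷ (wrongDirection , (reduce (merged (contains 71)) (contains 112))) ∷ (wrongDirection , (reduce (merged (overloaded 2 0 4 5)) (contains 112))) ∷ (wrongDirection , wrongDirection) ∷ ((reduce (merged (contains 80)) (contains 112)) , wrongDirection) ∷ ((reduce (merged (contains 55)) (contains 112)) , wrongDirection) ∷ ((reduce mergedAvailable (contains 112)) , wrongDirection) ∷ ((reduce (merged (contains 57)) (contains 112)) , wrongDirection) ∷ []))
  ∷ (mkPattern 8 ((0 , 3) ∷ (1 , 4) ∷ (2 , 5) ∷ (2 , 6) ∷ (3 , 7) ∷ []) ((2 , 5) ∷ (3 , 7) ∷ []) , ((wrongDirection , (reduce (merged (contains 41)) (contains 112))) ∷ (wrongDirection , (reduce (merged (contains 72)) (contains 113))) ∷ (wrongDirection , (reduce (merged (overloaded 2 4 5 6)) (contains 113))) ∷ (wrongDirection , wrongDirection) ∷ ((reduce (merged (contains 81)) (contains 113)) , wrongDirection) ∷ ((reduce (merged (contains 56)) (contains 113)) , wrongDirection) ∷ ((reduce mergedAvailable (contains 113)) , wrongDirection) ∷ ((reduce (merged (contains 57)) (contains 113)) , wrongDirection) ∷ []))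
  ∷ (mkPattern 8 ((0 , 3) ∷ (1 , 4) ∷ (2 , 5) ∷ (3 , 6) ∷ (3 , 7) ∷ []) ((0 , 3) ∷ (3 , 6) ∷ []) , ((wrongDirection , (reduce (merged (contains 42)) (contains 114))) ∷ (wrongDirection , (reduce (merged (contains 73)) (contains 114))) ∷ (wrongDirection , (reduce (merged (overloaded 2 0 4 5)) (contains 114))) ∷ (wrongDirection , wrongDirection) ∷ ((reduce (merged (overloaded 3 0 1 5)) (contains 114)) , wrongDirection) ∷ ((reduce (merged (contains 85)) (contains 114)) , wrongDirection) ∷ ((reduce (merged (contains 58)) (contains 114)) , wrongDirection) ∷ ((reduce mergedAvailable (contains 114)) , wrongDirection) ∷ []))
  ∷ (mkPattern 8 ((0 , 3) ∷ (1 , 4) ∷ (2 , 5) ∷ (3 , 6) ∷ (3 , 7) ∷ []) ((3 , 6) ∷ (3 , 7) ∷ []) , ((wrongDirection , (reduce (merged (contains 42)) (contains 114))) ∷ (wrongDirection , (reduce (merged (contains 74)) (contains 115))) ∷ (wrongDirection , (reduce (merged (overloaded 2 4 5 6)) (contains 115))) ∷ (wrongDirection , wrongDirection) ∷ ((reduce (merged (overloaded 3 1 5 6)) (contains 115)) , wrongDirection) ∷ ((reduce (merged (contains 86)) (contains 115)) , wrongDirection) ∷ ((reduce (merged (contains 59)) (contains 115)) , wrongDirection) ∷ ((reduce mergedAvailable (contains 115)) , wrongDirection) ∷ []))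
  ∷ (mkPattern 8 ((0 , 4) ∷ (0 , 5) ∷ (1 , 5) ∷ (2 , 6) ∷ (3 , 7) ∷ []) ((0 , 4) ∷ (1 , 5) ∷ []) , ((wrongDirection , (reduce mergedAvailable (contains 116))) ∷ (wrongDirection , (reduce (merged (contains 43)) (contains 116))) ∷ (wrongDirection , (reduce (merged (contains 77)) (contains 116))) ∷ (wrongDirection , (reduce (merged (contains 44)) (contains 116))) ∷ ((reduce (merged (contains 44)) (contains 116)) , wrongDirection) ∷ ((reduce mergedAvailable (contains 116)) , wrongDirection) ∷ ((reduce (merged (contains 87)) (contains 116)) , wrongDirection) ∷ ((reduce (merged (contains 88)) (contains 116)) , wrongDirection) ∷ []))
  ∷ (mkPattern 8 ((0 , 4) ∷ (0 , 5) ∷ (1 , 6) ∷ (2 , 6) ∷ (3 , 7) ∷ []) ((0 , 4) ∷ (2 , 6) ∷ []) , ((wrongDirection , (reduce (merged (contains 75)) (contains 117))) ∷ (wrongDirection , (reduce mergedAvailable (contains 117))) ∷ (wrongDirection , (reduce (merged (contains 45)) (contains 117))) ∷ (wrongDirection , (reduce (merged (contains 46)) (contains 117))) ∷ ((reduce (merged (contains 46)) (contains 117)) , wrongDirection) ∷ ((reduce mergedAvailable (contains 117)) , wrongDirection) ∷ ((reduce (merged (contains 87)) (contains 117)) , wrongDirection) ∷ ((reduce (merged (contains 89)) (contains 117)) , wrongDirection) ∷ []))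
  ∷ (mkPattern 8 ((0 , 4) ∷ (0 , 5) ∷ (1 , 6) ∷ (2 , 7) ∷ (3 , 7) ∷ []) ((0 , 4) ∷ (3 , 7) ∷ []) , ((wrongDirection , (reduce (merged (contains 76)) (contains 118))) ∷ (wrongDirection , (reduce (merged (contains 78)) (contains 118))) ∷ (wrongDirection , (reduce mergedAvailable (contains 118))) ∷ (wrongDirection , (reduce (merged (contains 47)) (contains 118))) ∷ ((reduce (merged (contains 47)) (contains 118)) , wrongDirection) ∷ ((reduce mergedAvailable (contains 118)) , wrongDirection) ∷ ((reduce (merged (contains 88)) (contains 118)) , wrongDirection) ∷ ((reduce (merged (contains 89)) (contains 118)) , wrongDirection) ∷ []))
  ∷ (mkPattern 8 ((0 , 4) ∷ (1 , 4) ∷ (2 , 5) ∷ (2 , 6) ∷ (3 , 7) ∷ []) ((1 , 4) ∷ (2 , 5) ∷ []) , ((wrongDirection , (reduce mergedAvailable (contains 119))) ∷ (wrongDirection , (reduce (merged (contains 48)) (contains 119))) ∷ (wrongDirection , (reduce (merged (contains 79)) (contains 119))) ∷ (wrongDirection , (reduce (merged (contains 81)) (contains 119))) ∷ ((reduce (merged (contains 80)) (contains 119)) , wrongDirection) ∷ ((reduce (merged (contains 62)) (contains 119)) , wrongDirection) ∷ ((reduce mergedAvailable (contains 119)) , wrongDirection) ∷ ((reduce (merged (contains 91)) (contains 119)) , wrongDirection) ∷ []))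
  ∷ (mkPattern 8 ((0 , 4) ∷ (1 , 4) ∷ (2 , 5) ∷ (3 , 6) ∷ (3 , 7) ∷ []) ((1 , 4) ∷ (3 , 6) ∷ []) , ((wrongDirection , (reduce mergedAvailable (contains 120))) ∷ (wrongDirection , (reduce (merged (contains 49)) (contains 120))) ∷ (wrongDirection , (reduce (merged (contains 79)) (contains 120))) ∷ (wrongDirection , (reduce (merged (overloaded 3 1 5 6)) (contains 120))) ∷ ((reduce (merged (overloaded 3 0 1 5)) (contains 120)) , wrongDirection) ∷ ((reduce (merged (contains 90)) (contains 120)) , wrongDirection) ∷ ((reduce (merged (contains 63)) (contains 120)) , wrongDirection) ∷ ((reduce mergedAvailable (contains 120)) , wrongDirection) ∷ []))
  ∷ (mkPattern 8 ((0 , 4) ∷ (1 , 4) ∷ (2 , 5) ∷ (3 , 6) ∷ (4 , 7) ∷ []) ((0 , 4) ∷ (1 , 4) ∷ []) , ((wrongDirection , (reduce mergedAvailable (contains 121))) ∷ (wrongDirection , (reduce (merged (contains 50)) (contains 121))) ∷ (wrongDirection , (reduce (merged (contains 80)) (contains 121))) ∷ (wrongDirection , (reduce (merged (overloaded 3 0 1 5)) (contains 121))) ∷ (wrongDirection , wrongDirection) ∷ ((reduce (merged (overloaded 4 0 1 2)) (contains 121)) , wrongDirection) ∷ ((reduce (merged (contains 92)) (contains 121)) , wrongDirection) ∷ ((reduce (merged (contains 64)) (contains 121)) , wrongDirection) ∷ []))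
  ∷ (mkPattern 8 ((0 , 4) ∷ (1 , 4) ∷ (2 , 5) ∷ (3 , 6) ∷ (4 , 7) ∷ []) ((1 , 4) ∷ (4 , 7) ∷ []) , ((wrongDirection , (reduce mergedAvailable (contains 121))) ∷ (wrongDirection , (reduce (merged (contains 51)) (contains 122))) ∷ (wrongDirection , (reduce (merged (contains 81)) (contains 122))) ∷ (wrongDirection , (reduce (merged (overloaded 3 1 5 6)) (contains 122))) ∷ (wrongDirection , wrongDirection) ∷ ((reduce (merged (overloaded 4 1 2 6)) (contains 122)) , wrongDirection) ∷ ((reduce (merged (contains 93)) (contains 122)) , wrongDirection) ∷ ((reduce (merged (contains 64)) (contains 122)) , wrongDirection) ∷ []))
  ∷ (mkPattern 8 ((0 , 4) ∷ (1 , 5) ∷ (1 , 6) ∷ (2 , 6) ∷ (3 , 7) ∷ []) ((1 , 5) ∷ (2 , 6) ∷ []) , ((wrongDirection , (reduce (merged (contains 75)) (contains 123))) ∷ (wrongDirection , (reduce mergedAvailable (contains 123))) ∷ (wrongDirection , (reduce (merged (contains 52)) (contains 123))) ∷ (wrongDirection , (reduce (merged (contains 84)) (contains 123))) ∷ ((reduce (merged (contains 83)) (contains 123)) , wrongDirection) ∷ ((reduce (merged (contains 60)) (contains 123)) , wrongDirection) ∷ ((reduce mergedAvailable (contains 123)) , wrongDirection) ∷ ((reduce (merged (contains 94)) (contains 123)) , wrongDirection) ∷ []))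
  ∷ (mkPattern 8 ((0 , 4) ∷ (1 , 5) ∷ (1 , 6) ∷ (2 , 7) ∷ (3 , 7) ∷ []) ((1 , 5) ∷ (3 , 7) ∷ []) , ((wrongDirection , (reduce (merged (contains 76)) (contains 124))) ∷ (wrongDirection , (reduce (merged (contains 82)) (contains 124))) ∷ (wrongDirection , (reduce mergedAvailable (contains 124))) ∷ (wrongDirection , (reduce (merged (contains 53)) (contains 124))) ∷ ((reduce (merged (contains 53)) (contains 124)) , wrongDirection) ∷ ((reduce (merged (contains 61)) (contains 124)) , wrongDirection) ∷ ((reduce mergedAvailable (contains 124)) , wrongDirection) ∷ ((reduce (merged (contains 94)) (contains 124)) , wrongDirection) ∷ []))
  ∷ (mkPattern 8 ((0 , 4) ∷ (1 , 5) ∷ (2 , 5) ∷ (3 , 6) ∷ (3 , 7) ∷ []) ((2 , 5) ∷ (3 , 6) ∷ []) , ((wrongDirection , (reduce (merged (contains 77)) (contains 125))) ∷ (wrongDirection , (reduce mergedAvailable (contains 125))) ∷ (wrongDirection , (reduce (merged (contains 54)) (contains 125))) ∷ (wrongDirection , (reduce (merged (contains 86)) (contains 125))) ∷ ((reduce (merged (contains 85)) (contains 125)) , wrongDirection) ∷ ((reduce (merged (contains 90)) (contains 125)) , wrongDirection) ∷ ((reduce (merged (contains 66)) (contains 125)) , wrongDirection) ∷ ((reduce mergedAvailable (contains 125)) , wrongDirection) ∷ []))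
  ∷ (mkPattern 8 ((0 , 4) ∷ (1 , 5) ∷ (2 , 5) ∷ (3 , 6) ∷ (4 , 7) ∷ []) ((0 , 4) ∷ (2 , 5) ∷ []) , ((wrongDirection , (reduce (merged (contains 44)) (contains 126))) ∷ (wrongDirection , (reduce mergedAvailable (contains 126))) ∷ (wrongDirection , (reduce (merged (contains 55)) (contains 126))) ∷ (wrongDirection , (reduce (merged (contains 85)) (contains 126))) ∷ (wrongDirection , wrongDirection) ∷ ((reduce (merged (overloaded 4 0 1 2)) (contains 126)) , wrongDirection) ∷ ((reduce (merged (contains 95)) (contains 126)) , wrongDirection) ∷ ((reduce (merged (contains 67)) (contains 126)) , wrongDirection) ∷ []))
  ∷ (mkPattern 8 ((0 , 4) ∷ (1 , 5) ∷ (2 , 5) ∷ (3 , 6) ∷ (4 , 7) ∷ []) ((2 , 5) ∷ (4 , 7) ∷ []) , ((wrongDirection , (reduce (merged (contains 44)) (contains 126))) ∷ (wrongDirection , (reduce mergedAvailable (contains 127))) ∷ (wrongDirection , (reduce (merged (contains 56)) (contains 127))) ∷ (wrongDirection , (reduce (merged (contains 86)) (contains 127))) ∷ (wrongDirection , wrongDirection) ∷ ((reduce (merged (overloaded 4 1 2 6)) (contains 127)) , wrongDirection) ∷ ((reduce (merged (contains 96)) (contains 127)) , wrongDirection) ∷ ((reduce (merged (contains 67)) (contains 127)) , wrongDirection) ∷ []))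
  ∷ (mkPattern 8 ((0 , 4) ∷ (1 , 5) ∷ (2 , 6) ∷ (2 , 7) ∷ (3 , 7) ∷ []) ((2 , 6) ∷ (3 , 7) ∷ []) , ((wrongDirection , (reduce (merged (contains 78)) (contains 128))) ∷ (wrongDirection , (reduce (merged (contains 82)) (contains 128))) ∷ (wrongDirection , (reduce mergedAvailable (contains 128))) ∷ (wrongDirection , (reduce (merged (contains 57)) (contains 128))) ∷ ((reduce (merged (contains 57)) (contains 128)) , wrongDirection) ∷ ((reduce (merged (contains 91)) (contains 128)) , wrongDirection) ∷ ((reduce (merged (contains 65)) (contains 128)) , wrongDirection) ∷ ((reduce mergedAvailable (contains 128)) , wrongDirection) ∷ []))
  ∷ (mkPattern 8 ((0 , 4) ∷ (1 , 5) ∷ (2 , 6) ∷ (3 , 6) ∷ (4 , 7) ∷ []) ((0 , 4) ∷ (3 , 6) ∷ []) , ((wrongDirection , (reduce (merged (contains 46)) (contains 129))) ∷ (wrongDirection , (reduce (merged (contains 83)) (contains 129))) ∷ (wrongDirection , (reduce mergedAvailable (contains 129))) ∷ (wrongDirection , (reduce (merged (contains 58)) (contains 129))) ∷ (wrongDirection , wrongDirection) ∷ ((reduce (merged (contains 92)) (contains 129)) , wrongDirection) ∷ ((reduce (merged (contains 95)) (contains 129)) , wrongDirection) ∷ ((reduce (merged (contains 68)) (contains 129)) , wrongDirection) ∷ []))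
  ∷ (mkPattern 8 ((0 , 4) ∷ (1 , 5) ∷ (2 , 6) ∷ (3 , 6) ∷ (4 , 7) ∷ []) ((3 , 6) ∷ (4 , 7) ∷ []) , ((wrongDirection , (reduce (merged (contains 46)) (contains 129))) ∷ (wrongDirection , (reduce (merged (contains 84)) (contains 130))) ∷ (wrongDirection , (reduce mergedAvailable (contains 130))) ∷ (wrongDirection , (reduce (merged (contains 59)) (contains 130))) ∷ (wrongDirection , wrongDirection) ∷ ((reduce (merged (contains 93)) (contains 130)) , wrongDirection) ∷ ((reduce (merged (contains 96)) (contains 130)) , wrongDirection) ∷ ((reduce (merged (contains 68)) (contains 130)) , wrongDirection) ∷ []))
  ∷ (mkPattern 8 ((0 , 5) ∷ (1 , 5) ∷ (2 , 5) ∷ (3 , 6) ∷ (4 , 7) ∷ []) ((1 , 5) ∷ (2 , 5) ∷ []) , ((wrongDirection , (reduce mergedAvailable (contains 131))) ∷ (wrongDirection , (reduce mergedAvailable (contains 131))) ∷ (wrongDirection , (reduce (merged (contains 62)) (contains 131))) ∷ (wrongDirection , (reduce (merged (contains 90)) (contains 131))) ∷ (wrongDirection , (reduce (merged (overloaded 4 1 2 6)) (contains 131))) ∷ ((reduce (merged (overloaded 4 0 1 2)) (contains 131)) , wrongDirection) ∷ ((reduce (merged (overloaded 5 1 2 3)) (contains 131)) , wrongDirection) ∷ ((reduce (merged (contains 97)) (contains 131)) , wrongDirection) ∷ []))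
  ∷ (mkPattern 8 ((0 , 5) ∷ (1 , 5) ∷ (2 , 6) ∷ (3 , 6) ∷ (4 , 7) ∷ []) ((1 , 5) ∷ (3 , 6) ∷ []) , ((wrongDirection , (reduce mergedAvailable (contains 132))) ∷ (wrongDirection , (reduce (merged (contains 60)) (contains 132))) ∷ (wrongDirection , (reduce mergedAvailable (contains 132))) ∷ (wrongDirection , (reduce (merged (contains 63)) (contains 132))) ∷ (wrongDirection , (reduce (merged (contains 93)) (contains 132))) ∷ ((reduce (merged (contains 92)) (contains 132)) , wrongDirection) ∷ ((reduce (merged (overloaded 5 1 2 3)) (contains 132)) , wrongDirection) ∷ ((reduce (merged (contains 98)) (contains 132)) , wrongDirection) ∷ []))
  ∷ (mkPattern 8 ((0 , 5) ∷ (1 , 5) ∷ (2 , 6) ∷ (3 , 7) ∷ (4 , 7) ∷ []) ((1 , 5) ∷ (4 , 7) ∷ []) , ((wrongDirection , (reduce mergedAvailable (contains 133))) ∷ (wrongDirection , (reduce (merged (contains 61)) (contains 133))) ∷ (wrongDirection , (reduce (merged (contains 91)) (contains 133))) ∷ (wrongDirection , (reduce mergedAvailable (contains 133))) ∷ (wrongDirection , (reduce (merged (contains 64)) (contains 133))) ∷ ((reduce (merged (contains 64)) (contains 133)) , wrongDirection) ∷ ((reduce (merged (contains 97)) (contains 133)) , wrongDirection) ∷ ((reduce (merged (contains 98)) (contains 133)) , wrongDirection) ∷ []))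
  ∷ (mkPattern 8 ((0 , 5) ∷ (1 , 6) ∷ (2 , 6) ∷ (3 , 6) ∷ (4 , 7) ∷ []) ((2 , 6) ∷ (3 , 6) ∷ []) , ((wrongDirection , (reduce (merged (contains 87)) (contains 134))) ∷ (wrongDirection , (reduce mergedAvailable (contains 134))) ∷ (wrongDirection , (reduce mergedAvailable (contains 134))) ∷ (wrongDirection , (reduce (merged (contains 66)) (contains 134))) ∷ (wrongDirection , (reduce (merged (contains 96)) (contains 134))) ∷ ((reduce (merged (contains 95)) (contains 134)) , wrongDirection) ∷ ((reduce (merged (overloaded 5 1 2 3)) (contains 134)) , wrongDirection) ∷ ((reduce (merged (overloaded 6 2 3 4)) (contains 134)) , wrongDirection) ∷ []))
  ∷ (mkPattern 8 ((0 , 5) ∷ (1 , 6) ∷ (2 , 6) ∷ (3 , 7) ∷ (4 , 7) ∷ []) ((2 , 6) ∷ (4 , 7) ∷ []) , ((wrongDirection , (reduce (merged (contains 88)) (contains 135))) ∷ (wrongDirection , (reduce mergedAvailable (contains 135))) ∷ (wrongDirection , (reduce (merged (contains 65)) (contains 135))) ∷ (wrongDirection , (reduce mergedAvailable (contains 135))) ∷ (wrongDirection , (reduce (merged (contains 67)) (contains 135))) ∷ ((reduce (merged (contains 67)) (contains 135)) , wrongDirection) ∷ ((reduce (merged (contains 97)) (contains 135)) , wrongDirection) ∷ ((reduce (merged (overloaded 6 2 3 4)) (contains 135)) , wrongDirection) ∷ []))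
  ∷ (mkPattern 8 ((0 , 5) ∷ (1 , 6) ∷ (2 , 7) ∷ (3 , 7) ∷ (4 , 7) ∷ []) ((3 , 7) ∷ (4 , 7) ∷ []) , ((wrongDirection , (reduce (merged (contains 89)) (contains 136))) ∷ (wrongDirection , (reduce (merged (contains 94)) (contains 136))) ∷ (wrongDirection , (reduce mergedAvailable (contains 136))) ∷ (wrongDirection , (reduce mergedAvailable (contains 136))) ∷ (wrongDirection , (reduce (merged (contains 68)) (contains 136))) ∷ ((reduce (merged (contains 68)) (contains 136)) , wrongDirection) ∷ ((reduce (merged (contains 98)) (contains 136)) , wrongDirection) ∷ ((reduce (merged (overloaded 6 2 3 4)) (contains 136)) , wrongDirection) ∷ []))
  ∷ (mkPattern 9 ((0 , 4) ∷ (0 , 5) ∷ (1 , 6) ∷ (2 , 7) ∷ (3 , 8) ∷ []) ((0 , 4) ∷ []) , ((wrongDirection , (reduce (merged (contains 104)) (contains 137))) ∷ (wrongDirection , (reduce (merged (contains 105)) (contains 137))) ∷ (wrongDirection , (reduce (merged (contains 106)) (contains 137))) ∷ (wrongDirection , (reduce (merged (contains 99)) (contains 137))) ∷ ((reduce (merged (contains 99)) (contains 137)) , wrongDirection) ∷ ((reduce mergedAvailable (contains 137)) , wrongDirection) ∷ ((reduce (merged (contains 116)) (contains 137)) , wrongDirection) ∷ ((reduce (merged (contains 117)) (contains 137)) , wrongDirection) ∷ ((reduce (merged (contains 118)) (contains 137)) , wrongDirection) ∷ []))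
  ∷ (mkPattern 9 ((0 , 4) ∷ (1 , 5) ∷ (1 , 6) ∷ (2 , 7) ∷ (3 , 8) ∷ []) ((1 , 5) ∷ []) , ((wrongDirection , (reduce (merged (contains 104)) (contains 138))) ∷ (wrongDirection , (reduce (merged (contains 107)) (contains 138))) ∷ (wrongDirection , (reduce (merged (contains 108)) (contains 138))) ∷ (wrongDirection , (reduce (merged (contains 110)) (contains 138))) ∷ ((reduce (merged (contains 109)) (contains 138)) , wrongDirection) ∷ ((reduce (merged (contains 100)) (contains 138)) , wrongDirection) ∷ ((reduce mergedAvailable (contains 138)) , wrongDirection) ∷ ((reduce (merged (contains 123)) (contains 138)) , wrongDirection) ∷ ((reduce (merged (contains 124)) (contains 138)) , wrongDirection) ∷ []))
  ∷ (mkPattern 9 ((0 , 4) ∷ (1 , 5) ∷ (2 , 6) ∷ (2 , 7) ∷ (3 , 8) ∷ []) ((2 , 6) ∷ []) , ((wrongDirection , (reduce (merged (contains 105)) (contains 139))) ∷ (wrongDirection , (reduce (merged (contains 107)) (contains 139))) ∷ (wrongDirection , (reduce (merged (contains 111)) (contains 139))) ∷ (wrongDirection , (reduce (merged (contains 113)) (contains 139))) ∷ ((reduce (merged (contains 112)) (contains 139)) , wrongDirection) ∷ ((reduce (merged (contains 119)) (contains 139)) , wrongDirection) ∷ ((reduce (merged (contains 101)) (contains 139)) , wrongDirection) ∷ ((reduce mergedAvailable (contains 139)) , wrongDirection) ∷ ((reduce (merged (contains 128)) (contains 139)) , wrongDirection) ∷ []))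
  ∷ (mkPattern 9 ((0 , 4) ∷ (1 , 5) ∷ (2 , 6) ∷ (3 , 7) ∷ (3 , 8) ∷ []) ((3 , 7) ∷ []) , ((wrongDirection , (reduce (merged (contains 106)) (contains 140))) ∷ (wrongDirection , (reduce (merged (contains 108)) (contains 140))) ∷ (wrongDirection , (reduce (merged (contains 111)) (contains 140))) ∷ (wrongDirection , (reduce (merged (contains 115)) (contains 140))) ∷ ((reduce (merged (contains 114)) (contains 140)) , wrongDirection) ∷ ((reduce (merged (contains 120)) (contains 140)) , wrongDirection) ∷ ((reduce (merged (contains 125)) (contains 140)) , wrongDirection) ∷ ((reduce (merged (contains 102)) (contains 140)) , wrongDirection) ∷ ((reduce mergedAvailable (contains 140)) , wrongDirection) ∷ []))
  ∷ (mkPattern 9 ((0 , 4) ∷ (1 , 5) ∷ (2 , 6) ∷ (3 , 7) ∷ (4 , 8) ∷ []) ((0 , 4) ∷ []) , ((wrongDirection , (reduce (merged (contains 99)) (contains 141))) ∷ (wrongDirection , (reduce (merged (contains 109)) (contains 141))) ∷ (wrongDirection , (reduce (merged (contains 112)) (contains 141))) ∷ (wrongDirection , (reduce (merged (contains 114)) (contains 141))) ∷ (wrongDirection , wrongDirection) ∷ ((reduce (merged (contains 121)) (contains 141)) , wrongDirection) ∷ ((reduce (merged (contains 126)) (contains 141)) , wrongDirection) ∷ ((reduce (merged (contains 129)) (contains 141)) , wrongDirection) ∷ ((reduce (merged (contains 103)) (contains 141)) , wrongDirection) ∷ []))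
  ∷ (mkPattern 9 ((0 , 4) ∷ (1 , 5) ∷ (2 , 6) ∷ (3 , 7) ∷ (4 , 8) ∷ []) ((4 , 8) ∷ []) , ((wrongDirection , (reduce (merged (contains 99)) (contains 141))) ∷ (wrongDirection , (reduce (merged (contains 110)) (contains 142))) ∷ (wrongDirection , (reduce (merged (contains 113)) (contains 142))) ∷ (wrongDirection , (reduce (merged (contains 115)) (contains 142))) ∷ (wrongDirection , wrongDirection) ∷ ((reduce (merged (contains 122)) (contains 142)) , wrongDirection) ∷ ((reduce (merged (contains 127)) (contains 142)) , wrongDirection) ∷ ((reduce (merged (contains 130)) (contains 142)) , wrongDirection) ∷ ((reduce (merged (contains 103)) (contains 142)) , wrongDirection) ∷ []))
  ∷ (mkPattern 9 ((0 , 5) ∷ (1 , 5) ∷ (2 , 6) ∷ (3 , 7) ∷ (4 , 8) ∷ []) ((1 , 5) ∷ []) , ((wrongDirection , (reduce mergedAvailable (contains 143))) ∷ (wrongDirection , (reduce (merged (contains 100)) (contains 143))) ∷ (wrongDirection , (reduce (merged (contains 119)) (contains 143))) ∷ (wrongDirection , (reduce (merged (contains 120)) (contains 143))) ∷ (wrongDirection , (reduce (merged (contains 122)) (contains 143))) ∷ ((reduce (merged (contains 121)) (contains 143)) , wrongDirection) ∷ ((reduce (merged (contains 131)) (contains 143)) , wrongDirection) ∷ ((reduce (merged (contains 132)) (contains 143)) , wrongDirection) ∷ ((reduce (merged (contains 133)) (contains 143)) , wrongDirection) ∷ []))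
  ∷ (mkPattern 9 ((0 , 5) ∷ (1 , 6) ∷ (2 , 6) ∷ (3 , 7) ∷ (4 , 8) ∷ []) ((2 , 6) ∷ []) , ((wrongDirection , (reduce (merged (contains 116)) (contains 144))) ∷ (wrongDirection , (reduce mergedAvailable (contains 144))) ∷ (wrongDirection , (reduce (merged (contains 101)) (contains 144))) ∷ (wrongDirection , (reduce (merged (contains 125)) (contains 144))) ∷ (wrongDirection , (reduce (merged (contains 127)) (contains 144))) ∷ ((reduce (merged (contains 126)) (contains 144)) , wrongDirection) ∷ ((reduce (merged (contains 131)) (contains 144)) , wrongDirection) ∷ ((reduce (merged (contains 134)) (contains 144)) , wrongDirection) ∷ ((reduce (merged (contains 135)) (contains 144)) , wrongDirection) ∷ []))
  ∷ (mkPattern 9 ((0 , 5) ∷ (1 , 6) ∷ (2 , 7) ∷ (3 , 7) ∷ (4 , 8) ∷ []) ((3 , 7) ∷ []) , ((wrongDirection , (reduce (merged (contains 117)) (contains 145))) ∷ (wrongDirection , (reduce (merged (contains 123)) (contains 145))) ∷ (wrongDirection , (reduce mergedAvailable (contains 145))) ∷ (wrongDirection , (reduce (merged (contains 102)) (contains 145))) ∷ (wrongDirection , (reduce (merged (contains 130)) (contains 145))) ∷ ((reduce (merged (contains 129)) (contains 145)) , wrongDirection) ∷ ((reduce (merged (contains 132)) (contains 145)) , wrongDirection) ∷ ((reduce (merged (contains 134)) (contains 145)) , wrongDirection) ∷ ((reduce (merged (contains 136)) (contains 145)) , wrongDirection) ∷ []))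
  ∷ (mkPattern 9 ((0 , 5) ∷ (1 , 6) ∷ (2 , 7) ∷ (3 , 8) ∷ (4 , 8) ∷ []) ((4 , 8) ∷ []) , ((wrongDirection , (reduce (merged (contains 118)) (contains 146))) ∷ (wrongDirection , (reduce (merged (contains 124)) (contains 146))) ∷ (wrongDirection , (reduce (merged (contains 128)) (contains 146))) ∷ (wrongDirection , (reduce mergedAvailable (contains 146))) ∷ (wrongDirection , (reduce (merged (contains 103)) (contains 146))) ∷ ((reduce (merged (contains 103)) (contains 146)) , wrongDirection) ∷ ((reduce (merged (contains 133)) (contains 146)) , wrongDirection) ∷ ((reduce (merged (contains 135)) (contains 146)) , wrongDirection) ∷ ((reduce (merged (contains 136)) (contains 146)) , wrongDirection) ∷ []))
  ∷ (mkPattern 10 ((0 , 5) ∷ (1 , 6) ∷ (2 , 7) ∷ (3 , 8) ∷ (4 , 9) ∷ []) ([]) , ((wrongDirection , (reduce (merged (contains 137)) (contains 147))) ∷ (wrongDirection , (reduce (merged (contains 138)) (contains 147))) ∷ (wrongDirection , (reduce (merged (contains 139)) (contains 147))) ∷ (wrongDirection , (reduce (merged (contains 140)) (contains 147))) ∷ (wrongDirection , (reduce (merged (contains 142)) (contains 147))) ∷ ((reduce (merged (contains 141)) (contains 147)) , wrongDirection) ∷ ((reduce (merged (contains 143)) (contains 147)) , wrongDirection) ∷ ((reduce (merged (contains 144)) (contains 147)) , wrongDirection) ∷ ((reduce (merged (contains 145)) (contains 147)) , wrongDirection) ∷ ((reduce (merged (contains 146)) (contains 147)) , wrongDirection) ∷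 []))
  ∷ []

family : List Pattern
family = map proj₁ entries

certificate : All (ValidEntry family) entries
certificate = toWitness {a? = all? (validEntry? family) entries} _

twist-in-family : Refutes family twistPattern (contains 147)
twist-in-family = toWitness {a? = refutes? family twistPattern (contains 147)} _

lemma3 : ∀ {n : ℕ} {E A : List Edge} → MonotoneOuterplanarDAG n E A →
         Σ (VertexOrder n E) (λ σ → ¬ Twist σ 5)
lemma3 = Stellation.twist-free family (certified entries certificate) (contains 147) twist-in-family
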